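{- Let $N\geq1$, $r=2N$, $d\ge 1$, and let $\Delta$ be the $(d-1)$-simplex on vertex set $[d]$; let $P$ be the poset of nonempty subsets of $[d]$ ordered by inclusion and $P_r$ the set of $r$-multichains $p_1\subseteq\cdots\subseteq p_r$ in $P$. Let $\imath:[r]\to[2r]$ be given by $\imath(t)=2t$ for $t$ even and $\imath(t)=2t-1$ for $t$ odd, and define $\mathfrak{p}\preceq_{II}\mathfrak{q}$ iff for all $t,s\in[r]$: $p_t\supseteq q_s$ if $s\leq\imath(t)-t$ and $p_t\subseteq q_s$ if $s>\imath(t)-t$. Let $\mathcal{C}^{II}_{2N}(\Delta)$ be the clique complex of the graph on $P_r$ in which distinct $\mathfrak{p},\mathfrak{q}$ are adjacent iff $\mathfrak{p}\preceq_{II}\mathfrak{q}$ or $\mathfrak{q}\preceq_{II}\mathfrak{p}$. Then $\mathcal{C}^{II}_{2N}(\Delta)$ is isomorphic (as an abstract simplicial complex) to the Cheeger–Müller–Schrader subdivision $\mathrm{CMS}_N(\Delta)$ of $\Delta$.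
   Context: Realize $\Delta$ as $\Delta_{d-1}=\{(t_1,\dots,t_d)\in\mathbb{R}^d:\sum t_i=1,\ t_i\geq0\}$. For each $j\in[d]$ let $C_j=\{t\in\Delta_{d-1}: t_j\geq t_i\ \forall i\}$ (a combinatorial cube). Subdivide each $C_j$ by the hyperplanes $\{t_i=\tfrac{k}{N}t_j\}$, $i\neq j$, $0\leq k\leq N$, into $N^{d-1}$ parallelepipeds, and then take the barycentric subdivision of each parallelepiped (simplices are convex hulls of barycenters of strictly increasing chains of faces of a parallelepiped). The resulting triangulation of $\Delta_{d-1}$ is the Cheeger–Müller–Schrader subdivision $\mathrm{CMS}_N(\Delta)$. -}

module Defs where

open import Data.Bool using (Bool; true; false; if_then_else_; _∧_)
open import Data.Nat as ℕ using (ℕ; zero; suc; _∸_; NonZero; _^_)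
open import Data.Nat.Properties using (m^n≢0)
open import Data.Fin as Fin using (Fin; toℕ)
open import Data.Fin.Subset using (Subset; _⊆_; Nonempty)
open import Data.Vec as Vec using (Vec; []; _∷_; lookup; tabulate)
open import Data.List as List using (List; []; _∷_; filter; foldr; map)
open import Data.List.Membership.Propositional using (_∈_)
open import Data.List.Relation.Unary.All using (All)
open import Data.Integer using (+_)
open import Data.Rational as ℚ using (ℚ; 0ℚ)
open import Data.Product using (Σ; ∃; _×_; _,_)
open import Data.Sum using (_⊎_)
open import Relation.Binary.PropositionalEquality using (_≡_; _≢_)
open import Relation.Nullary using (¬_; does)
open import Function.Bundles using (_⇔_)

-- Part 1: the clique complex C^{II}_r(Δ)
-- [d] = Fin d, [r] = {1..r} indexed by Fin r via t ↦ suc (toℕ t).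

Tuple : ℕ → ℕ → Set
Tuple r d = Vec (Subset d) r

IsMultichain : ∀ {r d} → Tuple r d → Set
IsMultichain {r} ps =
  ((t : Fin r) → Nonempty (lookup ps t)) ×
  ((t s : Fin r) → t Fin.≤ s → lookup ps t ⊆ lookup ps s)

iota : ℕ → ℕ
iota t = if does (t ℕ.% 2 ℕ.≟ 0) then 2 ℕ.* t else 2 ℕ.* t ∸ 1

idx : ∀ {r} → Fin r → ℕ
idx t = suc (toℕ t)

_≼II_ : ∀ {r d} → Tuple r d → Tuple r d → Set
_≼II_ {r} p q = (t s : Fin r) →
  ((idx s ℕ.≤ iota (idx t) ∸ idx t → lookup q s ⊆ lookup p t) ×
   (iota (idx t) ∸ idx t ℕ.< idx s → lookup p t ⊆ lookup q s))

AdjacentII : ∀ {r d} → Tuple r d → Tuple r d → Set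
AdjacentII p q = p ≼II q ⊎ q ≼II p

-- simplices of the clique complex, given as (nonempty) lists of vertices
-- (a finite vertex set, read up to membership)
CliqueSimplexII : ∀ {r d} → List (Tuple r d) → Set
CliqueSimplexII σ =
  (σ ≢ []) × All IsMultichain σ ×
  (∀ p q → p ∈ σ → q ∈ σ → p ≢ q → AdjacentII p q)

-- All vertices of CMS_N are
-- rational, so the complex is realised on its vertex set in ℚ^d.
-- A parallelepiped of C_j is given by j and k : Fin d → Fin N
-- (k i ignored for i = j): { t ∈ Δ : (k_i/N) t_j ≤ t_i ≤ ((k_i+1)/N) t_j }.
-- In the chart t_j = 1 it is a box; its faces choose for each i ≠ j the
-- lower endpoint, the upper endpoint, or the full interval.

data Side : Set where
  lo hi full : Side

Face : ℕ → Set
Face d = Fin d → Side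

FaceLE : ∀ {d} → Fin d → Face d → Face d → Set
FaceLE j φ ψ = ∀ i → i ≢ j → (φ i ≡ ψ i) ⊎ (ψ i ≡ full)

allBoolVecs : (d : ℕ) → List (Vec Bool d)
allBoolVecs zero = [] ∷ []
allBoolVecs (suc d) =
  List.concatMap (λ v → (false ∷ v) ∷ (true ∷ v) ∷ []) (allBoolVecs d)

isj : ∀ {d} → Fin d → Fin d → Bool
isj j i = does (i Fin.≟ j)

b2n : Bool → ℕ
b2n false = 0
b2n true = 1

-- ε selects a vertex of the face φ (ε_j fixed to false; lo ↦ false, hi ↦ true)
compatAt : Bool → Side → Bool → Bool
compatAt true _ e = Data.Bool.not e
compatAt false lo e = Data.Bool.not e
compatAt false hi e = e
compatAt false full e = true

compatible : ∀ {d} → Fin d → Face d → Vec Bool d → Bool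
compatible {d} j φ ε =
  Vec.foldr _ _∧_ true (tabulate (λ i → compatAt (isj j i) (φ i) (lookup ε i)))

vecSum : ∀ {n} → Vec ℕ n → ℕ
vecSum = Vec.foldr _ ℕ._+_ 0

nonZero+ : ∀ N m → .{{NonZero N}} → NonZero (N ℕ.+ m)
nonZero+ (suc N) m = _

-- the vertex of the parallelepiped (j,k) selected by ε, as a point of Δ:
-- unnormalised coordinates u_j = N, u_i = k_i + ε_i (i ≠ j), then t = u / Σ u
vertexPoint : ∀ {d} (N : ℕ) .{{_ : NonZero N}} →
  Fin d → (Fin d → Fin N) → Vec Bool d → Vec ℚ d
vertexPoint {d} N j k ε =
  tabulate (λ i → (+ (u i)) ℚ./ (N ℕ.+ rest)) 
  where
    w : Fin d → ℕ
    w i = if isj j i then 0 else toℕ (k i) ℕ.+ b2n (lookup ε i)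
    u : Fin d → ℕ
    u i = if isj j i then N else w i
    rest : ℕ
    rest = vecSum (tabulate w)
    instance
      nz : NonZero (N ℕ.+ rest)
      nz = nonZero+ N rest

numFull : ∀ {d} → Fin d → Face d → ℕ
numFull j φ =
  vecSum (tabulate (λ i → if isj j i then 0 else isFull (φ i)))
  where
    isFull : Side → ℕ
    isFull full = 1
    isFull _ = 0

-- barycenter (vertex average) of the face φ of the parallelepiped (j,k);
-- the face has exactly 2 ^ numFull j φ vertices.
barycenter : ∀ {d} (N : ℕ) .{{_ : NonZero N}} →
  Fin d → (Fin d → Fin N) → Face d → Vec ℚ d
barycenter {d} N j k φ =
  Vec.map (λ x → x ℚ.* ((+ 1) ℚ./ (2 ^ numFull j φ))) total
  where
    instance
      nz : NonZero (2 ^ numFull j φ)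
      nz = m^n≢0 2 (numFull j φ)
    total : Vec ℚ d
    total = foldr (Vec.zipWith ℚ._+_) (Vec.replicate d 0ℚ)
              (map (vertexPoint N j k)
                   (filter (λ ε → compatible j φ ε Data.Bool.≟ true)
                           (allBoolVecs d)))

IsCMSVertex : ∀ {d} (N : ℕ) .{{_ : NonZero N}} → Vec ℚ d → Set
IsCMSVertex {d} N v =
  Σ (Fin d) λ j → Σ (Fin d → Fin N) λ k → Σ (Face d) λ φ →
    barycenter N j k φ ≡ v

-- simplices of CMS_N(Δ): nonempty sets of barycenters of a chain of faces
-- of a single parallelepiped (i.e. subsets of a maximal-chain simplex)
CMSSimplex : ∀ {d} (N : ℕ) .{{_ : NonZero N}} → List (Vec ℚ d) → Set
CMSSimplex {d} N τ =
  (τ ≢ []) ×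
  Σ (Fin d) λ j → Σ (Fin d → Fin N) λ k → Σ (List (Face d)) λ Fs →
    (∀ φ ψ → φ ∈ Fs → ψ ∈ Fs → FaceLE j φ ψ ⊎ FaceLE j ψ φ) ×
    (∀ x → x ∈ τ → x ∈ map (barycenter N j k) Fs)

CliqueII≅CMS : (r d N : ℕ) .{{_ : NonZero N}} → Set
CliqueII≅CMS r d N =
  Σ (Tuple r d → Vec ℚ d) λ f →
    (∀ p → IsMultichain p → IsCMSVertex N (f p)) ×
    (∀ v → IsCMSVertex N v → ∃ λ p → IsMultichain p × (f p ≡ v)) ×
    (∀ p q → IsMultichain p → IsMultichain q → f p ≡ f q → p ≡ q) ×
    (∀ σ → All IsMultichain σ →
       (CliqueSimplexII σ ⇔ CMSSimplex N (map f σ)))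

-- A multichain p₁ ⊆ ⋯ ⊆ p_2N of nonempty subsets of [d] is determined by its multiplicity vector
-- a ∈ [0, 2N]^d, a_i = #{t | i ∈ p_t}, which has a_j = 2N for some j. Read as doubled coordinates,
-- such a vector codes a face of a CMS parallelepiped: j names the cube C_j, and a_i = 2k, 2k + 1, 2k + 2
-- stand for N t_i = k t_j, k t_j ≤ N t_i ≤ (k + 1) t_j and N t_i = (k + 1) t_j. The vertex map sends p
-- to the barycenter x of this face, and x determines a: N x_i / x_j equals c when a_i = 2c and lies
-- strictly between c and c + 1 when a_i = 2c + 1. Finally p ≼II q holds exactly when, coordinatewise,
-- the interval [⌊b_i/2⌋, ⌈b_i/2⌉] coded by q lies in the one coded by p, i.e. when the face of q is a
-- face of the face of p; so the cliques of the comparability graph are the chains of faces of one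
-- parallelepiped.

module Submission where

open import Defs
open import Data.Bool as Bool using (Bool; true; false; _∧_; if_then_else_)
open import Data.Bool.Properties using (T-≡) renaming (_≟_ to _≟ᵇ_)
open import Data.Nat
  using (ℕ; zero; suc; _+_; _*_; _∸_; _≤_; _<_; z≤n; s≤s; NonZero; >-nonZero⁻¹; _%_; _≤ᵇ_; _^_; ⌊_/2⌋)
import Data.Nat as ℕ
open import Data.Fin as Fin using (Fin; toℕ)
open import Data.Fin.Properties as Finₚ using (toℕ-fromℕ<; toℕ<n)
open import Data.Fin.Subset using (Subset; ∣_∣; inside; outside; _∈_; _⊆_; Nonempty)
open import Data.Fin.Subset.Properties using (∣p∣≤n)
open import Data.Vec as Vec using (Vec; []; _∷_; lookup; tabulate; _[_]≔_)
open import Data.List as List using (List; []; _∷_; _++_; map; concatMap; filter)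
open import Data.List.Properties using (filter-++; map-++; map-∘; map-cong)
open import Data.List.Membership.Propositional using () renaming (_∈_ to _∈ₗ_)
open import Data.List.Relation.Unary.Any using (here; there)
open import Data.List.Relation.Unary.All as All using (All)
open import Data.List.Membership.Propositional.Properties using (∈-map⁺; ∈-map⁻; ∈-concat⁺′; ∈-concat⁻′)
open import Data.Vec.Properties
  using (≡-dec; lookup-map; lookup∘update; lookup∘update′; tabulate-∘; lookup-zipWith; lookup-replicate;
         lookup∘tabulate; tabulate-cong; []=⇒lookup; lookup⇒[]=)
open import Data.Vec.Relation.Binary.Pointwise.Extensional using (ext; Pointwise-≡⇒≡)
open import Function.Bundles using (Equivalence; mk⇔)
open import Data.Nat.Properties
open import Data.Integer as ℤ using (+[1+_])
import Data.Integer.Properties as ℤₚ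
open import Data.Rational as ℚ using (ℚ; 0ℚ; toℚᵘ)
import Data.Rational.Properties as ℚₚ
open import Data.Rational.Unnormalised as ℚᵘ using (mkℚᵘ; *≡*; *<*; *≤*)
import Data.Rational.Unnormalised.Properties as ℚᵘₚ
open import Data.Product using (Σ; ∃; _×_; _,_; proj₁; proj₂)
open import Data.Sum using (_⊎_; inj₁; inj₂; [_,_]′; reduce)
open import Data.Empty using (⊥-elim)
open import Relation.Nullary using (¬_; yes; no; does)
open import Relation.Nullary.Decidable using (dec-true; dec-false)
open import Relation.Binary.Definitions using (tri<; tri≈; tri>)
open import Relation.Binary.PropositionalEquality
open import Function using (_∘_)
open import Data.Nat.Tactic.RingSolver using (solve-∀)

-- Parity and the threshold ı(t) − t

data Parity : ℕ → Set where
  even : ∀ c → Parity (c + c)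
  odd  : ∀ c → Parity (suc (c + c))

parity : ∀ n → Parity n
parity zero = even 0
parity (suc n) with parity n
... | even c = odd c
... | odd c rewrite sym (+-suc c c) = even (suc c)

double-cancel-≤ : ∀ {m n} → m + m ≤ n + n → m ≤ n
double-cancel-≤ p = ≮⇒≥ (λ n<m → <⇒≱ (+-mono-< n<m n<m) p)

double-cancel-< : ∀ {m n} → m + m < n + n → m < n
double-cancel-< p = ≰⇒> (λ n≤m → <⇒≱ p (+-mono-≤ n≤m n≤m))

m+m≢1+n+n : ∀ m n → m + m ≢ suc (n + n)
m+m≢1+n+n zero n ()
m+m≢1+n+n (suc m) zero p = 1+n≢0 (trans (sym (+-suc m m)) (suc-injective p))
m+m≢1+n+n (suc m) (suc n) p = m+m≢1+n+n m n (suc-injective (begin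
  suc (m + m)         ≡⟨ sym (+-suc m m) ⟩
  m + suc m           ≡⟨ suc-injective p ⟩
  suc (n + suc n)     ≡⟨ cong suc (+-suc n n) ⟩
  suc (suc (n + n))   ∎))
  where open ≡-Reasoning

m+m%2≡0 : ∀ m → (m + m) % 2 ≡ 0
m+m%2≡0 zero = refl
m+m%2≡0 (suc m) rewrite +-suc m m = m+m%2≡0 m

1+m+m%2≡1 : ∀ m → suc (m + m) % 2 ≡ 1
1+m+m%2≡1 zero = refl
1+m+m%2≡1 (suc m) rewrite +-suc m m = 1+m+m%2≡1 m

iota-even : ∀ t → t % 2 ≡ 0 → iota t ≡ 2 * t
iota-even t p rewrite p = refl

iota-odd : ∀ t → t % 2 ≡ 1 → iota t ≡ 2 * t ∸ 1
iota-odd t p rewrite p = refl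

-- ı(t) − t at the 1-based index t = w + 1: with 0-based s, p_t ⊇ q_s is required for s < threshold w.
threshold : ℕ → ℕ
threshold w = iota (suc w) ∸ suc w

threshold-even : ∀ e → threshold (e + e) ≡ e + e
threshold-even e = begin
  iota (suc w) ∸ suc w          ≡⟨ cong (_∸ suc w) (iota-odd (suc w) (1+m+m%2≡1 e)) ⟩
  2 * suc w ∸ 1 ∸ suc w          ≡⟨ cong (λ x → w + suc x ∸ suc w) (+-identityʳ w) ⟩
  w + suc w ∸ suc w              ≡⟨ m+n∸n≡m w (suc w) ⟩
  w                              ∎
  where
  open ≡-Reasoning
  w : ℕ
  w = e + e

threshold-odd : ∀ e → threshold (suc (e + e)) ≡ suc (suc (e + e))
threshold-odd e = begin
  iota (suc t) ∸ suc t      ≡⟨ cong (_∸ suc t) (iota-even (suc t) suc[t]%2≡0) ⟩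
  2 * suc t ∸ suc t          ≡⟨ cong (λ x → suc t + x ∸ suc t) (+-identityʳ (suc t)) ⟩
  suc t + suc t ∸ suc t      ≡⟨ m+n∸n≡m (suc t) (suc t) ⟩
  suc t                      ∎
  where
  open ≡-Reasoning
  t : ℕ
  t = suc (e + e)
  suc[t]%2≡0 : suc t % 2 ≡ 0
  suc[t]%2≡0 = subst (λ x → x % 2 ≡ 0) (cong suc (+-suc e e)) (m+m%2≡0 (suc e))

threshold-≤-suc : ∀ w → threshold w ≤ suc w
threshold-≤-suc w with parity w
... | even e = ≤-trans (≤-reflexive (threshold-even e)) (n≤1+n _)
... | odd e = ≤-reflexive (threshold-odd e)

threshold-≥ : ∀ w → w ≤ threshold w
threshold-≥ w with parity w
... | even e = ≤-reflexive (sym (threshold-even e))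
... | odd e = ≤-trans (n≤1+n _) (≤-reflexive (sym (threshold-odd e)))

m+m≤1+n+n⇒m+m≤n+n : ∀ m n → m + m ≤ suc (n + n) → m + m ≤ n + n
m+m≤1+n+n⇒m+m≤n+n m n p = +-mono-≤ m≤n m≤n
  where
  m≤n : m ≤ n
  m≤n = ≤-pred (double-cancel-< {m} {suc n} (≤-trans (s≤s p) (≤-reflexive (cong suc (sym (+-suc n n))))))

-- A code v stands for the interval [⌊v/2⌋, ⌈v/2⌉]; b ⊑ a says that the interval of b lies in that of a.
infix 4 _⊑_

data _⊑_ : ℕ → ℕ → Set where
  ⊑-refl : ∀ {a} → a ⊑ a
  lower⊑ : ∀ c → c + c ⊑ suc (c + c)
  upper⊑ : ∀ c → suc (suc (c + c)) ⊑ suc (c + c)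

_⊑ᵥ_ : ∀ {d} → Vec ℕ d → Vec ℕ d → Set
b ⊑ᵥ a = ∀ i → lookup b i ⊑ lookup a i

⊑-even : ∀ {a b} c → a ≡ c + c → b ⊑ a → b ≡ a
⊑-even c p ⊑-refl = refl
⊑-even c p (lower⊑ c′) = ⊥-elim (m+m≢1+n+n c c′ (sym p))
⊑-even c p (upper⊑ c′) = ⊥-elim (m+m≢1+n+n c c′ (sym p))

odd-⊑ : ∀ {a b} c → b ≡ suc (c + c) → b ⊑ a → a ≡ b
odd-⊑ c p ⊑-refl = refl
odd-⊑ c p (lower⊑ c′) = ⊥-elim (m+m≢1+n+n c′ c p)
odd-⊑ c p (upper⊑ c′) = ⊥-elim (m+m≢1+n+n c c′ (sym (suc-injective p)))

⊑-trans : ∀ {a b c} → c ⊑ b → b ⊑ a → c ⊑ a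
⊑-trans ⊑-refl q = q
⊑-trans p@(lower⊑ c) q = subst (_ ⊑_) (sym (odd-⊑ c refl q)) p
⊑-trans p@(upper⊑ c) q = subst (_ ⊑_) (sym (odd-⊑ c refl q)) p

⊑ᵥ-trans : ∀ {d} {a b c : Vec ℕ d} → c ⊑ᵥ b → b ⊑ᵥ a → c ⊑ᵥ a
⊑ᵥ-trans c⊑b b⊑a i = ⊑-trans (c⊑b i) (b⊑a i)

module _ (N : ℕ) where

  -- In a multichain of length N + N, i ∈ p_t iff N + N ≤ a_i + t (a_i the multiplicity of i, t 0-based),
  -- so these are the two clauses of p ≼II q at the coordinate i.
  Compatible : ℕ → ℕ → Set
  Compatible a b = ∀ w v → w < N + N → v < N + N →
    (v < threshold w → N + N ≤ b + v → N + N ≤ a + w) ×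
    (threshold w < suc v → N + N ≤ a + w → N + N ≤ b + v)

  ⊑-below : ∀ {a b w v} → b ⊑ a → v < threshold w → N + N ≤ b + v → N + N ≤ a + w
  ⊑-below {w = w} {v} ⊑-refl v<θw h = ≤-trans h (+-monoʳ-≤ _ (≤-pred (≤-trans v<θw (threshold-≤-suc w))))
  ⊑-below {w = w} {v} (lower⊑ c) v<θw h =
    ≤-trans h (+-mono-≤ (n≤1+n _) (≤-pred (≤-trans v<θw (threshold-≤-suc w))))
  ⊑-below {w = w} {v} (upper⊑ c) v<θw h with parity w
  ... | even e = ≤-trans h (≤-trans (≤-reflexive (sym (+-suc (suc (c + c)) v)))
                   (+-monoʳ-≤ _ (≤-trans v<θw (≤-reflexive (threshold-even e)))))
  ... | odd e = subst (N + N ≤_) (regroup c e) (m+m≤1+n+n⇒m+m≤n+n N (suc (c + e)) (subst (N + N ≤_) (regroup′ c e)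
                  (≤-trans h (+-monoʳ-≤ _ (≤-pred (≤-trans v<θw (≤-reflexive (threshold-odd e))))))))
    where
    regroup : ∀ c e → suc (c + e) + suc (c + e) ≡ suc (c + c) + suc (e + e)
    regroup = solve-∀
    regroup′ : ∀ c e → suc (suc (c + c)) + suc (e + e) ≡ suc (suc (c + e) + suc (c + e))
    regroup′ = solve-∀

  ⊑-above : ∀ {a b w v} → b ⊑ a → threshold w < suc v → N + N ≤ a + w → N + N ≤ b + v
  ⊑-above {w = w} {v} ⊑-refl θw≤v h = ≤-trans h (+-monoʳ-≤ _ (≤-trans (threshold-≥ w) (≤-pred θw≤v)))
  ⊑-above {w = w} {v} (upper⊑ c) θw≤v h =
    ≤-trans h (+-mono-≤ (n≤1+n _) (≤-trans (threshold-≥ w) (≤-pred θw≤v)))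
  ⊑-above {w = w} {v} (lower⊑ c) θw≤v h with parity w
  ... | even e = ≤-trans (subst (N + N ≤_) (regroup c e) (m+m≤1+n+n⇒m+m≤n+n N (c + e) (subst (N + N ≤_) (regroup′ c e) h)))
                   (+-monoʳ-≤ (c + c) (≤-trans (≤-reflexive (sym (threshold-even e))) (≤-pred θw≤v)))
    where
    regroup : ∀ c e → (c + e) + (c + e) ≡ (c + c) + (e + e)
    regroup = solve-∀
    regroup′ : ∀ c e → suc (c + c) + (e + e) ≡ suc ((c + e) + (c + e))
    regroup′ = solve-∀
  ... | odd e = ≤-trans h (≤-trans (≤-reflexive (sym (+-suc (c + c) (suc (e + e)))))
                  (+-monoʳ-≤ (c + c) (≤-trans (≤-reflexive (sym (threshold-odd e))) (≤-pred θw≤v))))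

  private
    split< : ∀ {c} → c < N → ∃ λ e → N + N ≡ suc (c + c) + suc (e + e)
    split< {c} c<N with m≤n⇒∃[o]m+o≡n c<N
    ... | e , refl = e , regroup c e
      where
      regroup : ∀ c e → suc (c + e) + suc (c + e) ≡ suc (c + c) + suc (e + e)
      regroup = solve-∀

    split≤ : ∀ {c} → c ≤ N → ∃ λ e → N + N ≡ (c + c) + (e + e)
    split≤ {c} c≤N with m≤n⇒∃[o]m+o≡n c≤N
    ... | e , refl = e , regroup c e
      where
      regroup : ∀ c e → (c + e) + (c + e) ≡ (c + c) + (e + e)
      regroup = solve-∀

  -- Each refutation below evaluates p ≼II q at a pair (t, s) placed just around the cut of a.
  no-rise-above-even : ∀ c {b} → Compatible (c + c) b → b ≤ N + N → ¬ (c + c < b)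
  no-rise-above-even c {b} comp b≤R c+c<b with split< {c} (double-cancel-< {c} (<-≤-trans c+c<b b≤R))
  ... | e , R≡ = <⇒≱ (≤-reflexive (sym R≡))
                   (proj₁ (comp w w w<R w<R) (≤-reflexive (sym (threshold-odd e)))
                     (≤-trans (≤-reflexive R≡) (+-monoˡ-≤ w c+c<b)))
    where
    w : ℕ
    w = suc (e + e)
    w<R : w < N + N
    w<R = subst (w <_) (sym R≡) (s≤s (m≤n+m w (c + c)))

  no-fall-below-even : ∀ c {b} → Compatible (c + c) b → c + c ≤ N + N → ¬ (b < c + c)
  no-fall-below-even c {b} comp c+c≤R b<c+c with split≤ {c} (double-cancel-≤ {c} c+c≤R)
  ... | e , R≡ = <⇒≱ (subst (b + w <_) (sym R≡) (+-monoˡ-< w b<c+c))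
                   (proj₂ (comp w w w<R w<R) (s≤s (≤-reflexive (threshold-even e))) (≤-reflexive R≡))
    where
    w : ℕ
    w = e + e
    w<R : w < N + N
    w<R = subst (w <_) (sym R≡) (+-monoˡ-≤ w (≤-trans (s≤s z≤n) b<c+c))

  no-fall-below-odd : ∀ c {b} → Compatible (suc (c + c)) b → suc (c + c) ≤ N + N → ¬ (b < c + c)
  no-fall-below-odd c {b} comp a≤R b<c+c with split< {c} (double-cancel-< {c} a≤R)
  ... | e , R≡ = <⇒≱ (subst (b + v <_) (sym R≡′) (+-monoˡ-< v b<c+c))
                   (proj₂ (comp w v w<R v<R) (s≤s (≤-reflexive (threshold-odd e))) (≤-reflexive R≡))
    where
    w v : ℕ
    w = suc (e + e)
    v = suc w
    R≡′ : N + N ≡ (c + c) + v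
    R≡′ = trans R≡ (sym (+-suc (c + c) w))
    v<R : v < N + N
    v<R = subst (v <_) (sym R≡) (+-monoˡ-≤ w (s≤s (≤-trans (s≤s z≤n) b<c+c)))
    w<R : w < N + N
    w<R = <-trans (n<1+n w) v<R

  no-rise-above-odd : ∀ c {b} → Compatible (suc (c + c)) b → b ≤ N + N → ¬ (suc (suc (c + c)) < b)
  no-rise-above-odd c {b} comp b≤R lt with split< {suc c} (double-cancel-< {suc c}
      (<-≤-trans (subst (_< b) (cong suc (sym (+-suc c c))) lt) b≤R))
  ... | e , R≡ = <⇒≱ (≤-reflexive (sym R≡′))
                   (proj₁ (comp w v w<R v<R)
                     (≤-trans (s≤s (≤-reflexive (sym (+-suc e e)))) (≤-reflexive (sym (threshold-even (suc e)))))
                     (≤-trans (≤-reflexive R≡″) (+-monoˡ-≤ v lt)))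
    where
    w v : ℕ
    w = suc e + suc e
    v = suc (e + e)
    R≡′ : N + N ≡ suc (suc (c + c) + w)
    R≡′ = trans R≡ (regroup c e)
      where
      regroup : ∀ c e → suc (suc c + suc c) + suc (e + e) ≡ suc (suc (c + c) + (suc e + suc e))
      regroup = solve-∀
    R≡″ : N + N ≡ suc (suc (suc (c + c))) + v
    R≡″ = trans R≡ (cong (λ x → suc (suc x) + v) (+-suc c c))
    w<R : w < N + N
    w<R = subst (w <_) (sym R≡′) (s≤s (m≤n+m w (suc (c + c))))
    v<R : v < N + N
    v<R = <-trans (s≤s (≤-reflexive (sym (+-suc e e)))) w<R

  compatible⇒⊑ : ∀ {a b} → a ≤ N + N → b ≤ N + N → Compatible a b → b ⊑ a
  compatible⇒⊑ {a} {b} a≤R b≤R comp with parity a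
  ... | even c = subst (_⊑ c + c)
                   (sym (≤-antisym (≮⇒≥ (no-rise-above-even c comp b≤R)) (≮⇒≥ (no-fall-below-even c comp a≤R))))
                   ⊑-refl
  ... | odd c with <-cmp b (suc (c + c))
  ...   | tri≈ _ refl _ = ⊑-refl
  ...   | tri< b<a _ _ = subst (_⊑ suc (c + c)) (≤-antisym (≮⇒≥ (no-fall-below-odd c comp a≤R)) (≤-pred b<a)) (lower⊑ c)
  ...   | tri> _ _ a<b = subst (_⊑ suc (c + c)) (≤-antisym a<b (≮⇒≥ (no-rise-above-odd c comp b≤R))) (upper⊑ c)

-- Multichains and their multiplicity vectors

lookup-ext : ∀ {A : Set} {n} {xs ys : Vec A n} → (∀ i → lookup xs i ≡ lookup ys i) → xs ≡ ys
lookup-ext pw = Pointwise-≡⇒≡ (ext pw)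

∈⇒lookup : ∀ {n} {x : Fin n} {p} → x ∈ p → lookup p x ≡ true
∈⇒lookup = []=⇒lookup

lookup⇒∈ : ∀ {n} {x : Fin n} {p} → lookup p x ≡ true → x ∈ p
lookup⇒∈ {x = x} {p} = lookup⇒[]= x p

≤ᵇ⇒≤′ : ∀ {m n} → (m ≤ᵇ n) ≡ true → m ≤ n
≤ᵇ⇒≤′ {m} {n} p = ≤ᵇ⇒≤ m n (Equivalence.from T-≡ p)

≤⇒≤ᵇ′ : ∀ {m n} → m ≤ n → (m ≤ᵇ n) ≡ true
≤⇒≤ᵇ′ p = Equivalence.to T-≡ (≤⇒≤ᵇ p)

1+m≤ᵇ1+n : ∀ m n → (suc m ≤ᵇ suc n) ≡ (m ≤ᵇ n)
1+m≤ᵇ1+n zero n = refl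
1+m≤ᵇ1+n (suc m) n = refl

atLeast : ∀ {r} → ℕ → Subset r
atLeast y = tabulate (λ t → y ≤ᵇ toℕ t)

atLeast-suc : ∀ {r} y → atLeast {suc r} (suc y) ≡ outside ∷ atLeast y
atLeast-suc y = cong (outside ∷_) (tabulate-cong (λ t → 1+m≤ᵇ1+n y (toℕ t)))

∣atLeast∣ : ∀ r y → ∣ atLeast {r} y ∣ ≡ r ∸ y
∣atLeast∣ zero y = sym (0∸n≡0 y)
∣atLeast∣ (suc r) zero = cong suc (∣atLeast∣ r zero)
∣atLeast∣ (suc r) (suc y) = trans (cong ∣_∣ (atLeast-suc {r} y)) (∣atLeast∣ r y)

UpClosed : ∀ {r} → Subset r → Set
UpClosed {r} c = ∀ {t s : Fin r} → t Fin.≤ s → lookup c t ≡ true → lookup c s ≡ true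

upClosed≡atLeast : ∀ {r} (c : Subset r) → UpClosed c → c ≡ atLeast (r ∸ ∣ c ∣)
upClosed≡atLeast [] _ = refl
upClosed≡atLeast {suc r} (outside ∷ c) up = begin
  outside ∷ c                       ≡⟨ cong (outside ∷_) (upClosed≡atLeast c (λ t≤s → up (s≤s t≤s))) ⟩
  outside ∷ atLeast (r ∸ ∣ c ∣)     ≡⟨ sym (atLeast-suc (r ∸ ∣ c ∣)) ⟩
  atLeast (suc (r ∸ ∣ c ∣))         ≡⟨ cong atLeast (sym (+-∸-assoc 1 (∣p∣≤n c))) ⟩
  atLeast (suc r ∸ ∣ c ∣)           ∎
  where open ≡-Reasoning
upClosed≡atLeast {suc r} (inside ∷ c) up = begin
  inside ∷ c                 ≡⟨ cong (inside ∷_) c≡⊤ ⟩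
  atLeast 0                  ≡⟨ cong atLeast (sym r∸∣c∣≡0) ⟩
  atLeast (r ∸ ∣ c ∣)        ∎
  where
  open ≡-Reasoning
  c≡⊤ : c ≡ atLeast 0
  c≡⊤ = lookup-ext (λ t → trans (up {Fin.zero} {Fin.suc t} z≤n refl) (sym (lookup∘tabulate _ t)))
  r∸∣c∣≡0 : r ∸ ∣ c ∣ ≡ 0
  r∸∣c∣≡0 = trans (cong (r ∸_) (trans (cong ∣_∣ c≡⊤) (∣atLeast∣ r 0))) (n∸n≡0 r)

module _ {r d : ℕ} where

  column : Tuple r d → Fin d → Subset r
  column p i = tabulate (λ t → lookup (lookup p t) i)

  fromColumns : (Fin d → Subset r) → Tuple r d
  fromColumns C = tabulate (λ t → tabulate (λ i → lookup (C i) t))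

  lookup-fromColumns : ∀ C t i → lookup (lookup (fromColumns C) t) i ≡ lookup (C i) t
  lookup-fromColumns C t i = trans (cong (λ x → lookup x i) (lookup∘tabulate _ t)) (lookup∘tabulate _ i)

  lookup-column : ∀ p i t → lookup (column p i) t ≡ lookup (lookup p t) i
  lookup-column p i t = lookup∘tabulate _ t

  multiplicities : Tuple r d → Vec ℕ d
  multiplicities p = tabulate (λ i → ∣ column p i ∣)

  multichainOf : Vec ℕ d → Tuple r d
  multichainOf a = fromColumns (λ i → atLeast (r ∸ lookup a i))

  multiplicity-≤ : ∀ p i → lookup (multiplicities p) i ≤ r
  multiplicity-≤ p i = subst (_≤ r) (sym (lookup∘tabulate _ i)) (∣p∣≤n (column p i))

  module _ (p : Tuple r d) (mp : IsMultichain p) where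

    column-upClosed : ∀ i → UpClosed (column p i)
    column-upClosed i {t} {s} t≤s i∈pₜ = trans (lookup-column p i s)
      (∈⇒lookup (proj₂ mp t s t≤s (lookup⇒∈ (trans (sym (lookup-column p i t)) i∈pₜ))))

    lookup-multichain : ∀ t i → lookup (lookup p t) i ≡ (r ∸ lookup (multiplicities p) i ≤ᵇ toℕ t)
    lookup-multichain t i = begin
      lookup (lookup p t) i                              ≡⟨ sym (lookup-column p i t) ⟩
      lookup (column p i) t                              ≡⟨ cong (λ c → lookup c t)
                                                              (upClosed≡atLeast (column p i) (column-upClosed i)) ⟩
      lookup (atLeast (r ∸ ∣ column p i ∣)) t            ≡⟨ lookup∘tabulate _ t ⟩
      (r ∸ ∣ column p i ∣ ≤ᵇ toℕ t)                      ≡⟨ cong (λ m → r ∸ m ≤ᵇ toℕ t) (sym (lookup∘tabulate _ i)) ⟩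
      (r ∸ lookup (multiplicities p) i ≤ᵇ toℕ t)         ∎
      where open ≡-Reasoning

    ∈-multichain⇒ : ∀ t i → i ∈ lookup p t → r ≤ lookup (multiplicities p) i + toℕ t
    ∈-multichain⇒ t i i∈pₜ = ≤-trans (m≤n+m∸n r aᵢ)
      (+-monoʳ-≤ aᵢ (≤ᵇ⇒≤′ (trans (sym (lookup-multichain t i)) (∈⇒lookup {p = lookup p t} i∈pₜ))))
      where
      aᵢ : ℕ
      aᵢ = lookup (multiplicities p) i

    ∈-multichain⇐ : ∀ t i → r ≤ lookup (multiplicities p) i + toℕ t → i ∈ lookup p t
    ∈-multichain⇐ t i h =
      lookup⇒∈ (trans (lookup-multichain t i) (≤⇒≤ᵇ′ (m≤n+o⇒m∸n≤o r (lookup (multiplicities p) i) h)))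

    multichainOf-multiplicities : multichainOf (multiplicities p) ≡ p
    multichainOf-multiplicities = lookup-ext λ t → lookup-ext λ i →
      trans (lookup-fromColumns (λ i → atLeast (r ∸ lookup (multiplicities p) i)) t i)
        (trans (lookup∘tabulate _ t) (sym (lookup-multichain t i)))

  multiplicities-multichainOf : ∀ a → (∀ i → lookup a i ≤ r) → multiplicities (multichainOf a) ≡ a
  multiplicities-multichainOf a a≤r = lookup-ext λ i → begin
    lookup (multiplicities (multichainOf a)) i   ≡⟨ lookup∘tabulate _ i ⟩
    ∣ column (multichainOf a) i ∣                ≡⟨ cong ∣_∣ (column≡ i) ⟩
    ∣ atLeast {r} (r ∸ lookup a i) ∣             ≡⟨ ∣atLeast∣ r (r ∸ lookup a i) ⟩
    r ∸ (r ∸ lookup a i)                         ≡⟨ m∸[m∸n]≡n (a≤r i) ⟩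
    lookup a i                                   ∎
    where
    open ≡-Reasoning
    column≡ : ∀ i → column (multichainOf a) i ≡ atLeast (r ∸ lookup a i)
    column≡ i = lookup-ext λ t → trans (lookup-column (multichainOf a) i t) (lookup-fromColumns (λ i → atLeast (r ∸ lookup a i)) t i)

  lookup-multichainOf : ∀ a t i → lookup (lookup (multichainOf a) t) i ≡ (r ∸ lookup a i ≤ᵇ toℕ t)
  lookup-multichainOf a t i = trans (lookup-fromColumns (λ i → atLeast (r ∸ lookup a i)) t i) (lookup∘tabulate _ t)

  multichainOf-isMultichain : ∀ a → (∃ λ j → lookup a j ≡ r) → IsMultichain (multichainOf a)
  multichainOf-isMultichain a (j , aⱼ≡r) = nonempty , chain
    where
    nonempty : ∀ t → Nonempty (lookup (multichainOf a) t)
    nonempty t = j , lookup⇒∈ (trans (lookup-multichainOf a t j)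
                       (≤⇒≤ᵇ′ (subst (_≤ toℕ t) (sym (trans (cong (r ∸_) aⱼ≡r) (n∸n≡0 r))) z≤n)))
    chain : ∀ t s → t Fin.≤ s → lookup (multichainOf a) t ⊆ lookup (multichainOf a) s
    chain t s t≤s {i} i∈pₜ = lookup⇒∈ (trans (lookup-multichainOf a s i) (≤⇒≤ᵇ′ (≤-trans entry≤t t≤s)))
      where
      entry≤t : r ∸ lookup a i ≤ toℕ t
      entry≤t = ≤ᵇ⇒≤′ (trans (sym (lookup-multichainOf a t i)) (∈⇒lookup {p = lookup (multichainOf a) t} i∈pₜ))

  multichain-full : ∀ {p} → IsMultichain p → 0 < r → ∃ λ j → lookup (multiplicities p) j ≡ r
  multichain-full {p} mp 0<r = j , ≤-antisym (multiplicity-≤ p j)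
      (subst (r ≤_) (trans (cong (aⱼ +_) (toℕ-fromℕ< 0<r)) (+-identityʳ aⱼ)) (∈-multichain⇒ p mp t₀ j j∈pₜ₀))
    where
    t₀ : Fin r
    t₀ = Fin.fromℕ< 0<r
    j : Fin d
    j = proj₁ (proj₁ mp t₀)
    j∈pₜ₀ : j ∈ lookup p t₀
    j∈pₜ₀ = proj₂ (proj₁ mp t₀)
    aⱼ : ℕ
    aⱼ = lookup (multiplicities p) j

module _ (N : ℕ) {d : ℕ} where

  private
    2N≡N+N : 2 * N ≡ N + N
    2N≡N+N = cong (N +_) (+-identityʳ N)

    member⇒ : ∀ (x : Tuple (2 * N) d) → IsMultichain x → ∀ t i → i ∈ lookup x t →
              N + N ≤ lookup (multiplicities x) i + toℕ t
    member⇒ x mx t i i∈ = subst (_≤ lookup (multiplicities x) i + toℕ t) 2N≡N+N (∈-multichain⇒ x mx t i i∈)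

    member⇐ : ∀ (x : Tuple (2 * N) d) → IsMultichain x → ∀ t i →
              N + N ≤ lookup (multiplicities x) i + toℕ t → i ∈ lookup x t
    member⇐ x mx t i h = ∈-multichain⇐ x mx t i (subst (_≤ lookup (multiplicities x) i + toℕ t) (sym 2N≡N+N) h)

  module _ {p q : Tuple (2 * N) d} (mp : IsMultichain p) (mq : IsMultichain q) where

    private
      a b : Vec ℕ d
      a = multiplicities p
      b = multiplicities q

    ⊑⇒≼II : multiplicities q ⊑ᵥ multiplicities p → p ≼II q
    ⊑⇒≼II b⊑a t s = (λ s<θt {i} i∈qₛ → member⇐ p mp t i (⊑-below N (b⊑a i) s<θt (member⇒ q mq s i i∈qₛ)))
                  , (λ θt≤s {i} i∈pₜ → member⇐ q mq s i (⊑-above N (b⊑a i) θt≤s (member⇒ p mp t i i∈pₜ)))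

    ≼II⇒⊑ : p ≼II q → multiplicities q ⊑ᵥ multiplicities p
    ≼II⇒⊑ p≼q i = compatible⇒⊑ N (bound p) (bound q) a∼b
      where
      bound : ∀ x → lookup (multiplicities x) i ≤ N + N
      bound x = subst (lookup (multiplicities x) i ≤_) 2N≡N+N (multiplicity-≤ x i)
      a∼b : Compatible N (lookup a i) (lookup b i)
      a∼b w v w<R v<R = subst₂ (λ w v → (v < threshold w → N + N ≤ lookup b i + v → N + N ≤ lookup a i + w) ×
                                                (threshold w < suc v → N + N ≤ lookup a i + w → N + N ≤ lookup b i + v))
                                 (toℕ-fromℕ< w<r) (toℕ-fromℕ< v<r)
                                 ((λ s<θt h → member⇒ p mp t i (proj₁ (p≼q t s) s<θt (member⇐ q mq s i h)))
                                 , (λ θt≤s h → member⇒ q mq s i (proj₂ (p≼q t s) θt≤s (member⇐ p mp t i h))))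
        where
        w<r : w < 2 * N
        w<r = subst (w <_) (sym 2N≡N+N) w<R
        v<r : v < 2 * N
        v<r = subst (v <_) (sym 2N≡N+N) v<R
        t s : Fin (2 * N)
        t = Fin.fromℕ< w<r
        s = Fin.fromℕ< v<r

-- The vertices of a face of a CMS parallelepiped

keep : ∀ {A : Set} → (A → Bool) → List A → List A
keep g = filter (λ x → g x Bool.≟ true)

keep-single : ∀ {A : Set} (g : A → Bool) x → keep g (x ∷ []) ≡ (if g x then x ∷ [] else [])
keep-single g x with g x
... | true = refl
... | false = refl

keep-pair : ∀ {A : Set} (g : A → Bool) x y →
  keep g (x ∷ y ∷ []) ≡ (if g x then x ∷ [] else []) ++ (if g y then y ∷ [] else [])
keep-pair g x y = trans (filter-++ (λ z → g z Bool.≟ true) (x ∷ []) (y ∷ [])) (cong₂ _++_ (keep-single g x) (keep-single g y))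

everyCoordinate : ∀ {d} → (Fin d → Bool → Bool) → Vec Bool d → Bool
everyCoordinate ch ε = Vec.foldr _ _∧_ true (tabulate (λ i → ch i (lookup ε i)))

mapCoordinates : ∀ {d} → (Fin d → Bool → ℕ) → Vec Bool d → Vec ℕ d
mapCoordinates val ε = tabulate (λ i → val i (lookup ε i))

-- the first coordinate varies fastest, as in allBoolVecs
cartesian : ∀ {d} → (Fin d → List ℕ) → List (Vec ℕ d)
cartesian {zero} C = [] ∷ []
cartesian {suc d} C = concatMap (λ v → map (_∷ v) (C Fin.zero)) (cartesian (λ i → C (Fin.suc i)))

choices : (Bool → Bool) → (Bool → ℕ) → List ℕ
choices ch val = map val (keep ch (false ∷ true ∷ []))

module _ {d} (ch : Fin (suc d) → Bool → Bool) (val : Fin (suc d) → Bool → ℕ) where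
  private
    dup : Vec Bool d → List (Vec Bool (suc d))
    dup v = (false ∷ v) ∷ (true ∷ v) ∷ []
    G : Vec Bool (suc d) → Bool
    G = everyCoordinate ch
    G′ : Vec Bool d → Bool
    G′ = everyCoordinate (λ i → ch (Fin.suc i))
    V : Vec Bool (suc d) → Vec ℕ (suc d)
    V = mapCoordinates val
    V′ : Vec Bool d → Vec ℕ d
    V′ = mapCoordinates (λ i → val (Fin.suc i))
    F : Vec ℕ d → List (Vec ℕ (suc d))
    F w = map (_∷ w) (choices (ch Fin.zero) (val Fin.zero))

    extend : ∀ v → map V (keep G (dup v)) ≡ (if G′ v then F (V′ v) else [])
    extend v = trans (cong (map V) (keep-pair G (false ∷ v) (true ∷ v)))
      (trans by-cases (cong (λ l → if G′ v then map (_∷ V′ v) (map (val Fin.zero) l) else [])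
                            (sym (keep-pair (ch Fin.zero) false true))))
      where
      by-cases : map V ((if ch Fin.zero false ∧ G′ v then (false ∷ v) ∷ [] else [])
                        ++ (if ch Fin.zero true ∧ G′ v then (true ∷ v) ∷ [] else []))
                 ≡ (if G′ v then map (_∷ V′ v) (map (val Fin.zero)
                       ((if ch Fin.zero false then false ∷ [] else []) ++ (if ch Fin.zero true then true ∷ [] else [])))
                    else [])
      by-cases with ch Fin.zero false | ch Fin.zero true | G′ v
      ... | false | false | false = refl
      ... | false | false | true  = refl
      ... | false | true  | false = refl
      ... | false | true  | true  = refl
      ... | true  | false | false = refl
      ... | true  | false | true  = refl
      ... | true  | true  | false = refl
      ... | true  | true  | true  = refl

    keep-cons : ∀ v vs → (if G′ v then F (V′ v) else []) ++ concatMap F (map V′ (keep G′ vs))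
                       ≡ concatMap F (map V′ (keep G′ (v ∷ vs)))
    keep-cons v vs with G′ v
    ... | true = refl
    ... | false = refl

  enumerate-step : ∀ vs →
    map (mapCoordinates val) (keep (everyCoordinate ch) (concatMap (λ v → (false ∷ v) ∷ (true ∷ v) ∷ []) vs))
    ≡ concatMap (λ w → map (_∷ w) (choices (ch Fin.zero) (val Fin.zero)))
                (map (mapCoordinates (λ i → val (Fin.suc i))) (keep (everyCoordinate (λ i → ch (Fin.suc i))) vs))
  enumerate-step [] = refl
  enumerate-step (v ∷ vs) = begin
    map V (keep G (dup v ++ concatMap dup vs))                    ≡⟨ cong (map V) (filter-++ (λ z → G z Bool.≟ true) (dup v) _) ⟩
    map V (keep G (dup v) ++ keep G (concatMap dup vs))           ≡⟨ map-++ V (keep G (dup v)) _ ⟩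
    map V (keep G (dup v)) ++ map V (keep G (concatMap dup vs))   ≡⟨ cong₂ _++_ (extend v) (enumerate-step vs) ⟩
    (if G′ v then F (V′ v) else []) ++ concatMap F (map V′ (keep G′ vs)) ≡⟨ keep-cons v vs ⟩
    concatMap F (map V′ (keep G′ (v ∷ vs)))                       ∎
    where open ≡-Reasoning

enumerate : ∀ d (ch : Fin d → Bool → Bool) (val : Fin d → Bool → ℕ) →
  map (mapCoordinates val) (keep (everyCoordinate ch) (allBoolVecs d)) ≡ cartesian (λ i → choices (ch i) (val i))
enumerate zero ch val = refl
enumerate (suc d) ch val = trans (enumerate-step ch val (allBoolVecs d))
  (cong (concatMap (λ v → map (_∷ v) (choices (ch Fin.zero) (val Fin.zero))))
        (enumerate d (λ i → ch (Fin.suc i)) (λ i → val (Fin.suc i))))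

infix 8 _/1+_

_/1+_ : ℕ → ℕ → ℚ
m /1+ s = ℤ.+ m ℚ./ suc s

⟦_⟧ : ℕ → ℚ
⟦ n ⟧ = n /1+ 0

toℚᵘ-/1+ : ∀ m s → toℚᵘ (m /1+ s) ℚᵘ.≃ mkℚᵘ (ℤ.+ m) s
toℚᵘ-/1+ m s = ℚₚ.toℚᵘ-fromℚᵘ (mkℚᵘ (ℤ.+ m) s)

/1+-mono-< : ∀ {m n} s → m < n → m /1+ s ℚ.< n /1+ s
/1+-mono-< {m} {n} s m<n = ℚₚ.toℚᵘ-cancel-<
  (ℚᵘₚ.<-respˡ-≃ (ℚᵘₚ.≃-sym (toℚᵘ-/1+ m s)) (ℚᵘₚ.<-respʳ-≃ (ℚᵘₚ.≃-sym (toℚᵘ-/1+ n s))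
    (*<* (ℤₚ.*-monoʳ-<-pos +[1+ s ] (ℤ.+<+ m<n)))))

/1+-mono-≤ : ∀ {m n} s → m ≤ n → m /1+ s ℚ.≤ n /1+ s
/1+-mono-≤ {m} {n} s m≤n = ℚₚ.toℚᵘ-cancel-≤
  (ℚᵘₚ.≤-respˡ-≃ (ℚᵘₚ.≃-sym (toℚᵘ-/1+ m s)) (ℚᵘₚ.≤-respʳ-≃ (ℚᵘₚ.≃-sym (toℚᵘ-/1+ n s))
    (*≤* (ℤₚ.*-monoʳ-≤-nonNeg +[1+ s ] (ℤ.+≤+ m≤n)))))

⟦⟧*/1+ : ∀ k m s → ⟦ k ⟧ ℚ.* m /1+ s ≡ (k * m) /1+ s
⟦⟧*/1+ k m s = ℚₚ.toℚᵘ-injective (ℚᵘₚ.≃-trans (ℚₚ.toℚᵘ-homo-* ⟦ k ⟧ (m /1+ s))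
  (ℚᵘₚ.≃-trans (ℚᵘₚ.*-cong (toℚᵘ-/1+ k 0) (toℚᵘ-/1+ m s))
    (ℚᵘₚ.≃-trans (*≡* cross) (ℚᵘₚ.≃-sym (toℚᵘ-/1+ (k * m) s)))))
  where
  cross : (ℤ.+ k ℤ.* ℤ.+ m) ℤ.* +[1+ s ] ≡ ℤ.+ (k * m) ℤ.* ℤ.+ (suc (s + 0 * suc s))
  cross rewrite sym (ℤₚ.pos-* k m) | +-identityʳ s = refl

0/1+ : ∀ s → 0 /1+ s ≡ 0ℚ
0/1+ s = ℚₚ.0/n≡0 (suc s)

sumOver : ∀ {A : Set} → (A → ℚ) → List A → ℚ
sumOver f = List.foldr (λ u s → f u ℚ.+ s) 0ℚ

module _ {A : Set} where

  sumOver-mono-≤ : ∀ {f g : A → ℚ} L → (∀ u → u ∈ₗ L → f u ℚ.≤ g u) → sumOver f L ℚ.≤ sumOver g L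
  sumOver-mono-≤ [] _ = ℚₚ.≤-refl
  sumOver-mono-≤ (u ∷ L) f≤g = ℚₚ.+-mono-≤ (f≤g u (here refl)) (sumOver-mono-≤ L (λ v v∈ → f≤g v (there v∈)))

  sumOver-mono-< : ∀ {f g : A → ℚ} L → (∀ u → u ∈ₗ L → f u ℚ.≤ g u) →
                   ∀ {w} → w ∈ₗ L → f w ℚ.< g w → sumOver f L ℚ.< sumOver g L
  sumOver-mono-< (u ∷ L) f≤g (here refl) f<g = ℚₚ.+-mono-<-≤ f<g (sumOver-mono-≤ L (λ v v∈ → f≤g v (there v∈)))
  sumOver-mono-< (u ∷ L) f≤g (there w∈) f<g =
    ℚₚ.+-mono-≤-< (f≤g u (here refl)) (sumOver-mono-< L (λ v v∈ → f≤g v (there v∈)) w∈ f<g)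

  sumOver-cong : ∀ {f g : A → ℚ} L → (∀ u → u ∈ₗ L → f u ≡ g u) → sumOver f L ≡ sumOver g L
  sumOver-cong [] _ = refl
  sumOver-cong (u ∷ L) f≡g = cong₂ ℚ._+_ (f≡g u (here refl)) (sumOver-cong L (λ v v∈ → f≡g v (there v∈)))

  *-sumOver : ∀ x (f : A → ℚ) L → x ℚ.* sumOver f L ≡ sumOver (λ u → x ℚ.* f u) L
  *-sumOver x f [] = ℚₚ.*-zeroʳ x
  *-sumOver x f (u ∷ L) = trans (ℚₚ.*-distribˡ-+ x (f u) (sumOver f L)) (cong (x ℚ.* f u ℚ.+_) (*-sumOver x f L))

vsum : ∀ {d} → List (Vec ℚ d) → Vec ℚ d
vsum {d} = List.foldr (Vec.zipWith ℚ._+_) (Vec.replicate d 0ℚ)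

lookup-vsum : ∀ {d} {A : Set} (g : A → Vec ℚ d) L i → lookup (vsum (map g L)) i ≡ sumOver (λ u → lookup (g u) i) L
lookup-vsum g [] i = lookup-replicate i 0ℚ
lookup-vsum g (u ∷ L) i = trans (lookup-zipWith ℚ._+_ i (g u) (vsum (map g L))) (cong (lookup (g u) i ℚ.+_) (lookup-vsum g L i))

nearestToHalf : ℕ → List ℕ
nearestToHalf zero = 0 ∷ []
nearestToHalf (suc zero) = 0 ∷ 1 ∷ []
nearestToHalf (suc (suc v)) = map suc (nearestToHalf v)

nearestToHalf-even : ∀ c → nearestToHalf (c + c) ≡ c ∷ []
nearestToHalf-even zero = refl
nearestToHalf-even (suc c) rewrite +-suc c c | nearestToHalf-even c = refl

nearestToHalf-odd : ∀ c → nearestToHalf (suc (c + c)) ≡ c ∷ suc c ∷ []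
nearestToHalf-odd zero = refl
nearestToHalf-odd (suc c) rewrite +-suc c c | nearestToHalf-odd c = refl

module _ {d : ℕ} where

  -- u / (u₁ + ⋯ + u_d), with junk value 0 for u = 0
  normalise : Vec ℕ d → Vec ℚ d
  normalise u = tabulate (λ i → lookup u i /1+ (vecSum u ∸ 1))

  grid : Vec ℕ d → List (Vec ℕ d)
  grid a = cartesian (λ i → nearestToHalf (lookup a i))

  oddCount : Vec ℕ d → ℕ
  oddCount a = vecSum (Vec.map (_% 2) a)

  codeBarycenter : Vec ℕ d → Vec ℚ d
  codeBarycenter a = Vec.map (λ x → x ℚ.* (ℤ.+ 1 ℚ./ 2 ^ oddCount a) {{m^n≢0 2 (oddCount a)}}) (vsum (map normalise (grid a)))

/-cong : ∀ {m n : ℤ.ℤ} {D E : ℕ} .{{_ : NonZero D}} .{{_ : NonZero E}} → m ≡ n → D ≡ E → m ℚ./ D ≡ n ℚ./ E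
/-cong refl refl = refl

isj-refl : ∀ {d} (j : Fin d) → isj j j ≡ true
isj-refl j = dec-true (j Fin.≟ j) refl

isj-≢ : ∀ {d} {i j : Fin d} → i ≢ j → isj j i ≡ false
isj-≢ {i = i} {j} i≢j = dec-false (i Fin.≟ j) i≢j

vecSum-swap : ∀ {d} (j : Fin d) (g h : Fin d → ℕ) → (∀ i → i ≢ j → g i ≡ h i) →
              vecSum (tabulate g) + h j ≡ vecSum (tabulate h) + g j
vecSum-swap {suc d} Fin.zero g h g≡h
  rewrite tabulate-cong {f = λ i → g (Fin.suc i)} {g = λ i → h (Fin.suc i)} (λ i → g≡h (Fin.suc i) (λ ()))
  = regroup (g Fin.zero) (vecSum (tabulate (λ i → h (Fin.suc i)))) (h Fin.zero)
  where
  regroup : ∀ a t b → a + t + b ≡ b + t + a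
  regroup = solve-∀
vecSum-swap {suc d} (Fin.suc j) g h g≡h rewrite g≡h Fin.zero (λ ()) = begin
  h₀ + Σg + h (Fin.suc j)   ≡⟨ +-assoc h₀ Σg _ ⟩
  h₀ + (Σg + h (Fin.suc j)) ≡⟨ cong (h₀ +_) (vecSum-swap j (λ i → g (Fin.suc i)) (λ i → h (Fin.suc i))
                                 (λ i i≢j → g≡h (Fin.suc i) (λ eq → i≢j (Finₚ.suc-injective eq)))) ⟩
  h₀ + (Σh + g (Fin.suc j)) ≡⟨ sym (+-assoc h₀ Σh _) ⟩
  h₀ + Σh + g (Fin.suc j)   ∎
  where
  open ≡-Reasoning
  h₀ Σg Σh : ℕ
  h₀ = h Fin.zero
  Σg = vecSum (tabulate (λ i → g (Fin.suc i)))
  Σh = vecSum (tabulate (λ i → h (Fin.suc i)))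

sideCode : ℕ → Side → ℕ
sideCode k lo = k + k
sideCode k full = suc (k + k)
sideCode k hi = suc (suc (k + k))

cartesian-cong : ∀ {d} {C D : Fin d → List ℕ} → (∀ i → C i ≡ D i) → cartesian C ≡ cartesian D
cartesian-cong {zero} _ = refl
cartesian-cong {suc d} {C} {D} C≡D rewrite C≡D Fin.zero
  | cartesian-cong {d} {λ i → C (Fin.suc i)} {λ i → D (Fin.suc i)} (λ i → C≡D (Fin.suc i)) = refl

module _ {d : ℕ} (N : ℕ) where

  faceCode : Fin d → (Fin d → Fin N) → Face d → Vec ℕ d
  faceCode j k φ = tabulate (λ i → if isj j i then N + N else sideCode (toℕ (k i)) (φ i))

  faceCode-top : ∀ j k φ → lookup (faceCode j k φ) j ≡ N + N
  faceCode-top j k φ = trans (lookup∘tabulate _ j) (cong (if_then N + N else _) (isj-refl j))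

  faceCode-side : ∀ {i j} k φ → i ≢ j → lookup (faceCode j k φ) i ≡ sideCode (toℕ (k i)) (φ i)
  faceCode-side {i} {j} k φ i≢j = trans (lookup∘tabulate _ i) (cong (if_then N + N else _) (isj-≢ i≢j))

  -- numFull's summand is local to Defs; it is recovered by unification.
  numFull-summand : (j : Fin d) (φ : Face d) → Σ (Fin d → ℕ) λ f → numFull j φ ≡ vecSum (tabulate f)
  numFull-summand j φ = _ , refl

  numFull≡oddCount : ∀ j k φ → numFull j φ ≡ oddCount (faceCode j k φ)
  numFull≡oddCount j k φ = begin
    numFull j φ                                       ≡⟨ proj₂ (numFull-summand j φ) ⟩
    vecSum (tabulate (proj₁ (numFull-summand j φ)))   ≡⟨ cong vecSum (tabulate-cong summand) ⟩
    vecSum (tabulate (λ i → code i % 2))              ≡⟨ cong vecSum (tabulate-∘ (_% 2) code) ⟩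
    oddCount (faceCode j k φ)                         ∎
    where
    open ≡-Reasoning
    code : Fin d → ℕ
    code i = if isj j i then N + N else sideCode (toℕ (k i)) (φ i)
    summand : ∀ i → proj₁ (numFull-summand j φ) i ≡ code i % 2
    summand i with isj j i
    ... | true = sym (m+m%2≡0 N)
    ... | false with φ i
    ...   | lo = sym (m+m%2≡0 (toℕ (k i)))
    ...   | hi = sym (m+m%2≡0 (toℕ (k i)))
    ...   | full = sym (1+m+m%2≡1 (toℕ (k i)))

  vertexValue : Fin d → (Fin d → Fin N) → Fin d → Bool → ℕ
  vertexValue j k i e = if isj j i then N else toℕ (k i) + b2n e

  vertexPoint≡normalise : .{{_ : NonZero N}} → ∀ j k ε →
    vertexPoint N j k ε ≡ normalise (mapCoordinates (vertexValue j k) ε)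
  vertexPoint≡normalise {{N≢0}} j k ε =
    tabulate-cong λ i → /-cong {{nonZero+ N (vecSum (tabulate w))}} (cong ℤ.+_ (coordinate i)) denominator
    where
    u : Vec ℕ d
    u = mapCoordinates (vertexValue j k) ε
    w : Fin d → ℕ
    w i = if isj j i then 0 else toℕ (k i) + b2n (lookup ε i)
    coordinate : ∀ i → (if isj j i then N else w i) ≡ lookup u i
    coordinate i rewrite lookup∘tabulate (λ i → vertexValue j k i (lookup ε i)) i with isj j i
    ... | true = refl
    ... | false = refl
    off-top : ∀ i → i ≢ j → vertexValue j k i (lookup ε i) ≡ w i
    off-top i i≢j rewrite isj-≢ i≢j = refl
    total : vecSum u ≡ N + vecSum (tabulate w)
    total = begin
      vecSum u                      ≡⟨ sym (+-identityʳ _) ⟩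
      vecSum u + 0                  ≡⟨ cong (vecSum u +_) (sym (cong (if_then 0 else toℕ (k j) + b2n (lookup ε j)) (isj-refl j))) ⟩
      vecSum u + w j                ≡⟨ vecSum-swap j _ w off-top ⟩
      vecSum (tabulate w) + vertexValue j k j (lookup ε j)
                                    ≡⟨ cong (λ b → vecSum (tabulate w) + (if b then N else toℕ (k j) + b2n (lookup ε j))) (isj-refl j) ⟩
      vecSum (tabulate w) + N       ≡⟨ +-comm _ N ⟩
      N + vecSum (tabulate w)       ∎
      where open ≡-Reasoning
    denominator : N + vecSum (tabulate w) ≡ suc (vecSum u ∸ 1)
    denominator = trans (sym (suc-pred (N + vecSum (tabulate w)) {{nonZero+ N (vecSum (tabulate w))}}))
                        (cong (λ m → suc (m ∸ 1)) (sym total))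

  choices-faceCode : ∀ j k φ i →
    choices (compatAt (isj j i) (φ i)) (vertexValue j k i) ≡ nearestToHalf (lookup (faceCode j k φ) i)
  choices-faceCode j k φ i rewrite lookup∘tabulate (λ i → if isj j i then N + N else sideCode (toℕ (k i)) (φ i)) i
    with isj j i
  ... | true = sym (nearestToHalf-even N)
  ... | false with φ i
  ...   | lo = trans (cong (_∷ []) (+-identityʳ _)) (sym (nearestToHalf-even _))
  ...   | hi rewrite nearestToHalf-even (toℕ (k i)) = cong (_∷ []) (+-comm _ 1)
  ...   | full rewrite nearestToHalf-odd (toℕ (k i)) = cong₂ (λ a b → a ∷ b ∷ []) (+-identityʳ _) (+-comm _ 1)

  barycenter≡codeBarycenter : .{{_ : NonZero N}} → ∀ j k φ → barycenter N j k φ ≡ codeBarycenter (faceCode j k φ)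
  barycenter≡codeBarycenter {{N≢0}} j k φ =
    cong₂ (λ s t → Vec.map (λ x → x ℚ.* s) t)
      (/-cong {ℤ.+ 1} {{m^n≢0 2 (numFull j φ)}} {{m^n≢0 2 (oddCount (faceCode j k φ))}} refl
              (cong (2 ^_) (numFull≡oddCount j k φ)))
      (cong vsum (begin
        map (vertexPoint N j k) vertices                               ≡⟨ map-cong (vertexPoint≡normalise j k) vertices ⟩
        map (normalise ∘ mapCoordinates (vertexValue j k)) vertices    ≡⟨ map-∘ vertices ⟩
        map normalise (map (mapCoordinates (vertexValue j k)) vertices)
          ≡⟨ cong (map normalise) (enumerate d (λ i → compatAt (isj j i) (φ i)) (vertexValue j k)) ⟩
        map normalise (cartesian (λ i → choices (compatAt (isj j i) (φ i)) (vertexValue j k i)))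
          ≡⟨ cong (map normalise) (cartesian-cong (choices-faceCode j k φ)) ⟩
        map normalise (grid (faceCode j k φ))                         ∎))
    where
    open ≡-Reasoning
    vertices : List (Vec Bool d)
    vertices = keep (compatible j φ) (allBoolVecs d)

-- A barycenter determines the code of its face

module _ {X : ℚ} (0<X : 0ℚ ℚ.< X) where

  private
    instance
      X-pos : ℚ.Positive X
      X-pos = ℚ.positive 0<X

  ⟦⟧*-mono-< : ∀ {m n} → m < n → ⟦ m ⟧ ℚ.* X ℚ.< ⟦ n ⟧ ℚ.* X
  ⟦⟧*-mono-< m<n = ℚₚ.*-monoˡ-<-pos X (/1+-mono-< 0 m<n)

  ⟦⟧*-mono-≤ : ∀ {m n} → m ≤ n → ⟦ m ⟧ ℚ.* X ℚ.≤ ⟦ n ⟧ ℚ.* X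
  ⟦⟧*-mono-≤ m≤n = ℚₚ.*-monoʳ-≤-nonNeg X {{ℚₚ.pos⇒nonNeg X}} (/1+-mono-≤ 0 m≤n)

  ⟦⟧*-cancel-< : ∀ m n → ⟦ m ⟧ ℚ.* X ℚ.< ⟦ n ⟧ ℚ.* X → m < n
  ⟦⟧*-cancel-< m n lt = ≰⇒> (λ n≤m → ℚₚ.<-irrefl refl (ℚₚ.<-≤-trans lt (⟦⟧*-mono-≤ n≤m)))

  ⟦⟧*-injective : ∀ m n → ⟦ m ⟧ ℚ.* X ≡ ⟦ n ⟧ ℚ.* X → m ≡ n
  ⟦⟧*-injective m n eq = ≤-antisym (≮⇒≥ (λ n<m → ℚₚ.<-irrefl (sym eq) (⟦⟧*-mono-< n<m)))
                                (≮⇒≥ (λ m<n → ℚₚ.<-irrefl eq (⟦⟧*-mono-< m<n)))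

data Located (X y : ℚ) : ℕ → Set where
  at      : ∀ c → y ≡ ⟦ c ⟧ ℚ.* X → Located X y (c + c)
  between : ∀ c → ⟦ c ⟧ ℚ.* X ℚ.< y → y ℚ.< ⟦ suc c ⟧ ℚ.* X → Located X y (suc (c + c))

module _ {X : ℚ} (0<X : 0ℚ ℚ.< X) {y : ℚ} where

  located-unique : ∀ {v w} → Located X y v → Located X y w → v ≡ w
  located-unique (at c y≡) (at c′ y≡′) = cong (λ n → n + n) (⟦⟧*-injective 0<X c c′ (trans (sym y≡) y≡′))
  located-unique (at c y≡) (between c′ l h) = ⊥-elim (<⇒≱ (⟦⟧*-cancel-< 0<X c (suc c′) (subst (ℚ._< _) y≡ h))
                                                             (⟦⟧*-cancel-< 0<X c′ c (subst (_ ℚ.<_) y≡ l)))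
  located-unique (between c l h) (at c′ y≡′) = ⊥-elim (<⇒≱ (⟦⟧*-cancel-< 0<X c′ (suc c) (subst (ℚ._< _) y≡′ h))
                                                             (⟦⟧*-cancel-< 0<X c c′ (subst (_ ℚ.<_) y≡′ l)))
  located-unique (between c l h) (between c′ l′ h′) =
    cong (λ n → suc (n + n)) (≤-antisym (≤-pred (⟦⟧*-cancel-< 0<X c (suc c′) (ℚₚ.<-trans l h′)))
                                       (≤-pred (⟦⟧*-cancel-< 0<X c′ (suc c) (ℚₚ.<-trans l′ h))))

  located-≤ : ∀ {v} N → Located X y v → v ≤ N + N → y ℚ.≤ ⟦ N ⟧ ℚ.* X
  located-≤ N (at c y≡) c+c≤ = subst (ℚ._≤ _) (sym y≡) (⟦⟧*-mono-≤ 0<X (double-cancel-≤ {c} {N} c+c≤))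
  located-≤ N (between c _ h) v≤ = ℚₚ.<⇒≤ (ℚₚ.<-≤-trans h (⟦⟧*-mono-≤ 0<X (double-cancel-< {c} {N} v≤)))

located-* : ∀ {X y v} s .{{_ : ℚ.Positive s}} → Located X y v → Located (X ℚ.* s) (y ℚ.* s) v
located-* {X} s (at c y≡) = at c (trans (cong (ℚ._* s) y≡) (ℚₚ.*-assoc ⟦ c ⟧ X s))
located-* {X} {y} s (between c l h) =
  between c (subst (ℚ._< y ℚ.* s) (ℚₚ.*-assoc ⟦ c ⟧ X s) (ℚₚ.*-monoˡ-<-pos s l))
            (subst (y ℚ.* s ℚ.<_) (ℚₚ.*-assoc ⟦ suc c ⟧ X s) (ℚₚ.*-monoˡ-<-pos s h))

∈-cartesian⁻ : ∀ {d} {C : Fin d → List ℕ} {u} → u ∈ₗ cartesian C → ∀ i → lookup u i ∈ₗ C i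
∈-cartesian⁻ {suc d} {C} u∈ i
  with ∈-concat⁻′ (map (λ v → map (_∷ v) (C Fin.zero)) (cartesian (λ i → C (Fin.suc i)))) u∈
... | xs , u∈xs , xs∈ with ∈-map⁻ (λ v → map (_∷ v) (C Fin.zero)) xs∈
...   | v , v∈ , refl with ∈-map⁻ (_∷ v) u∈xs
...     | x , x∈ , refl with i
...       | Fin.zero = x∈
...       | Fin.suc i′ = ∈-cartesian⁻ v∈ i′

∈-cartesian⁺ : ∀ {d} {C : Fin d → List ℕ} u → (∀ i → lookup u i ∈ₗ C i) → u ∈ₗ cartesian C
∈-cartesian⁺ [] _ = here refl
∈-cartesian⁺ {C = C} (x ∷ v) u∈ = ∈-concat⁺′ (∈-map⁺ (_∷ v) (u∈ Fin.zero))
  (∈-map⁺ (λ v → map (_∷ v) (C Fin.zero)) (∈-cartesian⁺ v (λ i → u∈ (Fin.suc i))))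

cartesian-hit : ∀ {d} {C : Fin d → List ℕ} → (∀ i → ∃ λ x → x ∈ₗ C i) →
                ∀ i {x} → x ∈ₗ C i → ∃ λ u → u ∈ₗ cartesian C × lookup u i ≡ x
cartesian-hit {C = C} pick i {x} x∈ = u , ∈-cartesian⁺ u coordinate , lookup∘update i picked x
  where
  picked u : Vec ℕ _
  picked = tabulate (λ i → proj₁ (pick i))
  u = picked [ i ]≔ x
  coordinate : ∀ i′ → lookup u i′ ∈ₗ C i′
  coordinate i′ with i′ Fin.≟ i
  ... | yes refl = subst (_∈ₗ C i) (sym (lookup∘update i picked x)) x∈
  ... | no i′≢i =
    subst (_∈ₗ C i′) (sym (trans (lookup∘update′ i′≢i picked x) (lookup∘tabulate _ i′))) (proj₂ (pick i′))

module _ {d} (N : ℕ) .{{_ : NonZero N}} {j : Fin d} (u : Vec ℕ d) (uⱼ≡N : lookup u j ≡ N) (i : Fin d) where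

  private
    S : ℕ
    S = vecSum u ∸ 1

    scaled-top : ∀ c → ⟦ c ⟧ ℚ.* lookup (normalise u) j ≡ (N * c) /1+ S
    scaled-top c = begin
      ⟦ c ⟧ ℚ.* lookup (normalise u) j ≡⟨ cong (⟦ c ⟧ ℚ.*_) (lookup∘tabulate _ j) ⟩
      ⟦ c ⟧ ℚ.* lookup u j /1+ S      ≡⟨ ⟦⟧*/1+ c (lookup u j) S ⟩
      (c * lookup u j) /1+ S          ≡⟨ cong (λ m → (c * m) /1+ S) uⱼ≡N ⟩
      (c * N) /1+ S                   ≡⟨ cong (_/1+ S) (*-comm c N) ⟩
      (N * c) /1+ S                   ∎
      where open ≡-Reasoning

    scaled-side : ⟦ N ⟧ ℚ.* lookup (normalise u) i ≡ (N * lookup u i) /1+ S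
    scaled-side = trans (cong (⟦ N ⟧ ℚ.*_) (lookup∘tabulate _ i)) (⟦⟧*/1+ N (lookup u i) S)

  vertex-at : ∀ {c} → lookup u i ≡ c → ⟦ N ⟧ ℚ.* lookup (normalise u) i ≡ ⟦ c ⟧ ℚ.* lookup (normalise u) j
  vertex-at {c} uᵢ≡c = trans scaled-side (trans (cong (λ m → (N * m) /1+ S) uᵢ≡c) (sym (scaled-top c)))

  vertex-above : ∀ {c} → c ≤ lookup u i → ⟦ c ⟧ ℚ.* lookup (normalise u) j ℚ.≤ ⟦ N ⟧ ℚ.* lookup (normalise u) i
  vertex-above {c} c≤uᵢ = subst₂ ℚ._≤_ (sym (scaled-top c)) (sym scaled-side) (/1+-mono-≤ S (*-monoʳ-≤ N c≤uᵢ))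

  vertex-strictly-above : ∀ {c} → c < lookup u i → ⟦ c ⟧ ℚ.* lookup (normalise u) j ℚ.< ⟦ N ⟧ ℚ.* lookup (normalise u) i
  vertex-strictly-above {c} c<uᵢ = subst₂ ℚ._<_ (sym (scaled-top c)) (sym scaled-side) (/1+-mono-< S (*-monoʳ-< N c<uᵢ))

  vertex-below : ∀ {c} → lookup u i ≤ c → ⟦ N ⟧ ℚ.* lookup (normalise u) i ℚ.≤ ⟦ c ⟧ ℚ.* lookup (normalise u) j
  vertex-below {c} uᵢ≤c = subst₂ ℚ._≤_ (sym scaled-side) (sym (scaled-top c)) (/1+-mono-≤ S (*-monoʳ-≤ N uᵢ≤c))

  vertex-strictly-below : ∀ {c} → lookup u i < c → ⟦ N ⟧ ℚ.* lookup (normalise u) i ℚ.< ⟦ c ⟧ ℚ.* lookup (normalise u) j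
  vertex-strictly-below {c} uᵢ<c = subst₂ ℚ._<_ (sym scaled-side) (sym (scaled-top c)) (/1+-mono-< S (*-monoʳ-< N uᵢ<c))

normalise-nonneg : ∀ {d} (u : Vec ℕ d) i → 0ℚ ℚ.≤ lookup (normalise u) i
normalise-nonneg u i = subst₂ ℚ._≤_ (0/1+ (vecSum u ∸ 1)) (sym (lookup∘tabulate (λ i → lookup u i /1+ (vecSum u ∸ 1)) i))
                                    (/1+-mono-≤ {0} {lookup u i} (vecSum u ∸ 1) z≤n)

normalise-pos : ∀ {d} (u : Vec ℕ d) i → 0 < lookup u i → 0ℚ ℚ.< lookup (normalise u) i
normalise-pos u i 0<uᵢ = subst₂ ℚ._<_ (0/1+ (vecSum u ∸ 1)) (sym (lookup∘tabulate (λ i → lookup u i /1+ (vecSum u ∸ 1)) i))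
                                      (/1+-mono-< (vecSum u ∸ 1) 0<uᵢ)

sumOver-0 : ∀ {A : Set} (L : List A) → sumOver (λ _ → 0ℚ) L ≡ 0ℚ
sumOver-0 [] = refl
sumOver-0 (_ ∷ L) = trans (ℚₚ.+-identityˡ _) (sumOver-0 L)

nearestToHalf-nonempty : ∀ v → ∃ λ x → x ∈ₗ nearestToHalf v
nearestToHalf-nonempty zero = 0 , here refl
nearestToHalf-nonempty (suc zero) = 0 , here refl
nearestToHalf-nonempty (suc (suc v)) with nearestToHalf-nonempty v
... | x , x∈ = suc x , ∈-map⁺ suc x∈

module _ {d} (N : ℕ) .{{_ : NonZero N}} (a : Vec ℕ d) {j : Fin d} (aⱼ≡2N : lookup a j ≡ N + N) where

  private
    L : List (Vec ℕ d)
    L = grid a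

    coordinate : Vec ℕ d → Fin d → ℚ
    coordinate u i = lookup (normalise u) i

    grid-coordinate : ∀ {u} → u ∈ₗ L → ∀ {v} i → lookup a i ≡ v → lookup u i ∈ₗ nearestToHalf v
    grid-coordinate u∈ i refl = ∈-cartesian⁻ u∈ i

    grid-top : ∀ u → u ∈ₗ L → lookup u j ≡ N
    grid-top u u∈ with subst (lookup u j ∈ₗ_) (nearestToHalf-even N) (grid-coordinate u∈ j aⱼ≡2N)
    ... | here uⱼ≡N = uⱼ≡N

    grid-hit : ∀ i {x} → x ∈ₗ nearestToHalf (lookup a i) → ∃ λ u → u ∈ₗ L × lookup u i ≡ x
    grid-hit = cartesian-hit (λ i → nearestToHalf-nonempty (lookup a i))

    gridTop : ℚ
    gridTop = sumOver (λ u → coordinate u j) L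

    gridTop-pos : 0ℚ ℚ.< gridTop
    gridTop-pos = subst (ℚ._< gridTop) (sumOver-0 L)
      (sumOver-mono-< L (λ u _ → normalise-nonneg u j) u∈ (normalise-pos u j (subst (0 <_) (sym (grid-top u u∈)) (>-nonZero⁻¹ N))))
      where
      some : ∃ λ u → u ∈ₗ L × lookup u j ≡ proj₁ (nearestToHalf-nonempty (lookup a j))
      some = grid-hit j (proj₂ (nearestToHalf-nonempty (lookup a j)))
      u : Vec ℕ d
      u = proj₁ some
      u∈ : u ∈ₗ L
      u∈ = proj₁ (proj₂ some)

    grid-even : ∀ i c → lookup a i ≡ c + c → ∀ u → u ∈ₗ L → lookup u i ≡ c
    grid-even i c aᵢ≡ u u∈ with subst (lookup u i ∈ₗ_) (nearestToHalf-even c) (grid-coordinate u∈ i aᵢ≡)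
    ... | here e = e

    grid-odd : ∀ i c → lookup a i ≡ suc (c + c) → ∀ u → u ∈ₗ L → c ≤ lookup u i × lookup u i ≤ suc c
    grid-odd i c aᵢ≡ u u∈ with subst (lookup u i ∈ₗ_) (nearestToHalf-odd c) (grid-coordinate u∈ i aᵢ≡)
    ... | here e = ≤-reflexive (sym e) , subst (_≤ suc c) (sym e) (n≤1+n c)
    ... | there (here e) = subst (c ≤_) (sym e) (n≤1+n c) , ≤-reflexive e

    grid-odd-hit : ∀ i c → lookup a i ≡ suc (c + c) → ∀ {x} → x ∈ₗ c ∷ suc c ∷ [] → ∃ λ u → u ∈ₗ L × lookup u i ≡ x
    grid-odd-hit i c aᵢ≡ x∈ = grid-hit i (subst (_ ∈ₗ_) (sym (trans (cong nearestToHalf aᵢ≡) (nearestToHalf-odd c))) x∈)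

    located-grid : ∀ i → Located gridTop (⟦ N ⟧ ℚ.* sumOver (λ u → coordinate u i) L) (lookup a i)
    located-grid i = subst (λ y → Located gridTop y (lookup a i)) (sym (*-sumOver ⟦ N ⟧ (λ u → coordinate u i) L))
                       (locate (parity (lookup a i)) refl)
      where
      Y : ℚ
      Y = sumOver (λ u → ⟦ N ⟧ ℚ.* coordinate u i) L
      scaleTop : ∀ c → ⟦ c ⟧ ℚ.* gridTop ≡ sumOver (λ u → ⟦ c ⟧ ℚ.* coordinate u j) L
      scaleTop c = *-sumOver ⟦ c ⟧ (λ u → coordinate u j) L
      locate : ∀ {v} → Parity v → lookup a i ≡ v → Located gridTop Y v
      locate (even c) aᵢ≡ =
        at c (trans (sumOver-cong L λ u u∈ → vertex-at N u (grid-top u u∈) i (grid-even i c aᵢ≡ u u∈)) (sym (scaleTop c)))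
      locate (odd c) aᵢ≡ =
        let u⁺ , u⁺∈ , u⁺ᵢ≡1+c = grid-odd-hit i c aᵢ≡ (there (here refl))
            u⁻ , u⁻∈ , u⁻ᵢ≡c = grid-odd-hit i c aᵢ≡ (here refl)
        in between c
        (subst (ℚ._< Y) (sym (scaleTop c))
          (sumOver-mono-< L (λ u u∈ → vertex-above N u (grid-top u u∈) i (proj₁ (grid-odd i c aᵢ≡ u u∈)))
            u⁺∈ (vertex-strictly-above N u⁺ (grid-top u⁺ u⁺∈) i (≤-reflexive (sym u⁺ᵢ≡1+c)))))
        (subst (Y ℚ.<_) (sym (scaleTop (suc c)))
          (sumOver-mono-< L (λ u u∈ → vertex-below N u (grid-top u u∈) i (proj₂ (grid-odd i c aᵢ≡ u u∈)))
            u⁻∈ (vertex-strictly-below N u⁻ (grid-top u⁻ u⁻∈) i (≤-reflexive (cong suc u⁻ᵢ≡c)))))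

  private
    instance
      2^k≢0 : NonZero (2 ^ oddCount a)
      2^k≢0 = m^n≢0 2 (oddCount a)

    scale : ℚ
    scale = ℤ.+ 1 ℚ./ 2 ^ oddCount a

    instance
      scale-pos : ℚ.Positive scale
      scale-pos = ℚₚ.normalize-pos 1 (2 ^ oddCount a)

    lookup-codeBarycenter : ∀ i → lookup (codeBarycenter a) i ≡ sumOver (λ u → coordinate u i) L ℚ.* scale
    lookup-codeBarycenter i = trans (lookup-map i (ℚ._* scale) (vsum (map normalise L)))
                                    (cong (ℚ._* scale) (lookup-vsum normalise L i))

  codeBarycenter-top-pos : 0ℚ ℚ.< lookup (codeBarycenter a) j
  codeBarycenter-top-pos = subst₂ ℚ._<_ (ℚₚ.*-zeroˡ scale) (sym (lookup-codeBarycenter j))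
                             (ℚₚ.*-monoˡ-<-pos scale gridTop-pos)

  located-codeBarycenter : ∀ i → Located (lookup (codeBarycenter a) j) (⟦ N ⟧ ℚ.* lookup (codeBarycenter a) i) (lookup a i)
  located-codeBarycenter i = subst₂ (λ X y → Located X y (lookup a i))
    (sym (lookup-codeBarycenter j))
    (trans (ℚₚ.*-assoc ⟦ N ⟧ _ scale) (cong (⟦ N ⟧ ℚ.*_) (sym (lookup-codeBarycenter i))))
    (located-* scale (located-grid i))

IsFaceCode : ∀ {d} → ℕ → Vec ℕ d → Set
IsFaceCode {d} N a = (∀ i → lookup a i ≤ N + N) × ∃ λ j → lookup a j ≡ N + N

codeBarycenter-injective : ∀ {d} N .{{_ : NonZero N}} {a b : Vec ℕ d} → IsFaceCode N a → IsFaceCode N b →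
                           codeBarycenter a ≡ codeBarycenter b → a ≡ b
codeBarycenter-injective {d} N {a} {b} (a≤2N , j , aⱼ≡2N) (b≤2N , j′ , bⱼ′≡2N) a↦x = lookup-ext λ i →
  located-unique 0<xⱼ (locatedᵃ i)
    (subst (λ X → Located X (⟦ N ⟧ ℚ.* lookup x i) (lookup b i)) (sym xⱼ≡xⱼ′) (locatedᵇ i))
  where
  x : Vec ℚ d
  x = codeBarycenter a
  locatedᵃ : ∀ i → Located (lookup x j) (⟦ N ⟧ ℚ.* lookup x i) (lookup a i)
  locatedᵃ = located-codeBarycenter N a aⱼ≡2N
  locatedᵇ : ∀ i → Located (lookup x j′) (⟦ N ⟧ ℚ.* lookup x i) (lookup b i)
  locatedᵇ i = subst (λ z → Located (lookup z j′) (⟦ N ⟧ ℚ.* lookup z i) (lookup b i)) (sym a↦x)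
                 (located-codeBarycenter N b bⱼ′≡2N i)
  0<xⱼ : 0ℚ ℚ.< lookup x j
  0<xⱼ = codeBarycenter-top-pos N a aⱼ≡2N
  0<xⱼ′ : 0ℚ ℚ.< lookup x j′
  0<xⱼ′ = subst (λ z → 0ℚ ℚ.< lookup z j′) (sym a↦x) (codeBarycenter-top-pos N b bⱼ′≡2N)
  instance
    N-pos : ℚ.Positive ⟦ N ⟧
    N-pos = ℚ.positive (subst (ℚ._< ⟦ N ⟧) (0/1+ 0) (/1+-mono-< 0 (>-nonZero⁻¹ N)))
  -- x_j is the largest coordinate of x for any top index j of either code
  xⱼ≡xⱼ′ : lookup x j ≡ lookup x j′
  xⱼ≡xⱼ′ = ℚₚ.≤-antisym (ℚₚ.*-cancelˡ-≤-pos ⟦ N ⟧ (located-≤ 0<xⱼ′ N (locatedᵇ j) (b≤2N j)))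
                        (ℚₚ.*-cancelˡ-≤-pos ⟦ N ⟧ (located-≤ 0<xⱼ N (locatedᵃ j′) (a≤2N j′)))

-- Charts: the faces of one parallelepiped

⌊1+n+n/2⌋≡n : ∀ n → ⌊ suc (n + n) /2⌋ ≡ n
⌊1+n+n/2⌋≡n zero = refl
⌊1+n+n/2⌋≡n (suc n) rewrite +-suc n n = cong suc (⌊1+n+n/2⌋≡n n)

-- the index k of a unit interval [k, k + 1] that contains the interval of the code v
cell : ℕ → ℕ
cell v = ⌊ v ∸ 1 /2⌋

cell-< : ∀ {N v} .{{_ : NonZero N}} → v ≤ N + N → cell v < N
cell-< {N} {zero} _ = >-nonZero⁻¹ N
cell-< {N} {suc v} 1+v≤2N = double-cancel-< {⌊ v /2⌋} {N} (≤-<-trans halves≤v 1+v≤2N)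
  where
  halves≤v : ⌊ v /2⌋ + ⌊ v /2⌋ ≤ v
  halves≤v = ≤-trans (+-monoʳ-≤ ⌊ v /2⌋ (⌊n/2⌋≤⌈n/2⌉ v)) (≤-reflexive (⌊n/2⌋+⌈n/2⌉≡n v))

self-in-cell : ∀ v → ∃ λ s → sideCode (cell v) s ≡ v
self-in-cell v with parity v
... | even zero = lo , refl
... | even (suc c) rewrite +-suc c c | ⌊1+n+n/2⌋≡n c = hi , refl
... | odd c = full , cong (λ k → suc (k + k)) (sym (n≡⌊n+n/2⌋ c))

⊑-in-cell : ∀ {a b} → b ⊑ a → ∃ λ s → sideCode (cell a) s ≡ b
⊑-in-cell {a} ⊑-refl = self-in-cell a
⊑-in-cell (lower⊑ c) = lo , cong (λ k → k + k) (sym (n≡⌊n+n/2⌋ c))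
⊑-in-cell (upper⊑ c) = hi , cong (λ k → suc (suc (k + k))) (sym (n≡⌊n+n/2⌋ c))

sideOf : ℕ → ℕ → Side
sideOf k v = if does (v % 2 ℕ.≟ 0) then (if does (v ℕ.≟ k + k) then lo else hi) else full

sideOf-sideCode : ∀ k s → sideOf k (sideCode k s) ≡ s
sideOf-sideCode k lo rewrite m+m%2≡0 k | dec-true (k + k ℕ.≟ k + k) refl = refl
sideOf-sideCode k hi rewrite m+m%2≡0 k | dec-false (suc (suc (k + k)) ℕ.≟ k + k) (λ eq → 1+n≰n (≤-trans (n≤1+n _) (≤-reflexive eq)))
  = refl
sideOf-sideCode k full rewrite 1+m+m%2≡1 k = refl

sideOf-odd : ∀ k c → sideOf k (suc (c + c)) ≡ full
sideOf-odd k c rewrite 1+m+m%2≡1 c = refl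

⊑⇒sideOf : ∀ k {a b} → b ⊑ a → sideOf k b ≡ sideOf k a ⊎ sideOf k a ≡ full
⊑⇒sideOf k ⊑-refl = inj₁ refl
⊑⇒sideOf k (lower⊑ c) = inj₂ (sideOf-odd k c)
⊑⇒sideOf k (upper⊑ c) = inj₂ (sideOf-odd k c)

sideCode-≤ : ∀ {k N} s → k < N → sideCode k s ≤ N + N
sideCode-≤ lo k<N = +-mono-≤ (<⇒≤ k<N) (<⇒≤ k<N)
sideCode-≤ {k} hi k<N = ≤-trans (≤-reflexive (cong suc (sym (+-suc k k)))) (+-mono-≤ k<N k<N)
sideCode-≤ {k} full k<N = ≤-trans (n≤1+n _) (sideCode-≤ hi k<N)

module _ {d : ℕ} (N : ℕ) .{{_ : NonZero N}} where

  faceCode-isFaceCode : ∀ (j : Fin d) k φ → IsFaceCode N (faceCode N j k φ)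
  faceCode-isFaceCode j k φ = bound , j , faceCode-top N j k φ
    where
    bound : ∀ i → lookup (faceCode N j k φ) i ≤ N + N
    bound i with i Fin.≟ j
    ... | yes refl = ≤-reflexive (faceCode-top N j k φ)
    ... | no i≢j = subst (_≤ N + N) (sym (faceCode-side N k φ i≢j)) (sideCode-≤ (φ i) (toℕ<n (k i)))

  chart : (T : Vec ℕ d) → (∀ i → lookup T i ≤ N + N) → Fin d → Fin N
  chart T T≤2N i = Fin.fromℕ< (cell-< (T≤2N i))

  faceOf : (Fin d → Fin N) → Vec ℕ d → Face d
  faceOf k b i = sideOf (toℕ (k i)) (lookup b i)

  faceCode-faceOf : ∀ {T b} (T≤2N : ∀ i → lookup T i ≤ N + N) {j} → lookup T j ≡ N + N →
                    b ⊑ᵥ T → faceCode N j (chart T T≤2N) (faceOf (chart T T≤2N) b) ≡ b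
  faceCode-faceOf {T} {b} T≤2N {j} Tⱼ≡2N b⊑T = lookup-ext coordinate
    where
    k : Fin d → Fin N
    k = chart T T≤2N
    coordinate : ∀ i → lookup (faceCode N j k (faceOf k b)) i ≡ lookup b i
    coordinate i with i Fin.≟ j
    ... | yes refl = trans (faceCode-top N i k (faceOf k b)) (sym (trans (⊑-even N Tⱼ≡2N (b⊑T i)) Tⱼ≡2N))
    ... | no i≢j with ⊑-in-cell (b⊑T i)
    ...   | s , code≡bᵢ = begin
      lookup (faceCode N j k (faceOf k b)) i  ≡⟨ faceCode-side N k (faceOf k b) i≢j ⟩
      sideCode κ (sideOf κ (lookup b i))      ≡⟨ cong (λ κ → sideCode κ (sideOf κ (lookup b i))) (toℕ-fromℕ< (cell-< (T≤2N i)))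
                                               ⟩
      sideCode c (sideOf c (lookup b i))      ≡⟨ cong (λ v → sideCode c (sideOf c v)) (sym code≡bᵢ) ⟩
      sideCode c (sideOf c (sideCode c s))    ≡⟨ cong (sideCode c) (sideOf-sideCode c s) ⟩
      sideCode c s                            ≡⟨ code≡bᵢ ⟩
      lookup b i                              ∎
      where
      open ≡-Reasoning
      κ c : ℕ
      κ = toℕ (k i)
      c = cell (lookup T i)

  faceLE⇒⊑ : ∀ (j : Fin d) k {φ ψ} → FaceLE j φ ψ → faceCode N j k φ ⊑ᵥ faceCode N j k ψ
  faceLE⇒⊑ j k {φ} {ψ} φ≤ψ i with i Fin.≟ j
  ... | yes refl = subst₂ _⊑_ (sym (faceCode-top N i k φ)) (sym (faceCode-top N i k ψ)) ⊑-refl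
  ... | no i≢j = subst₂ _⊑_ (sym (faceCode-side N k φ i≢j)) (sym (faceCode-side N k ψ i≢j)) (sides (φ≤ψ i i≢j))
    where
    sides : φ i ≡ ψ i ⊎ ψ i ≡ full → sideCode (toℕ (k i)) (φ i) ⊑ sideCode (toℕ (k i)) (ψ i)
    sides (inj₁ φᵢ≡ψᵢ) rewrite φᵢ≡ψᵢ = ⊑-refl
    sides (inj₂ ψᵢ≡full) rewrite ψᵢ≡full with φ i
    ... | lo = lower⊑ (toℕ (k i))
    ... | hi = upper⊑ (toℕ (k i))
    ... | full = ⊑-refl

  ⊑⇒faceLE : ∀ (j : Fin d) k {b b′ : Vec ℕ d} → b ⊑ᵥ b′ → FaceLE j (faceOf k b) (faceOf k b′)
  ⊑⇒faceLE j k b⊑b′ i _ = ⊑⇒sideOf (toℕ (k i)) (b⊑b′ i)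

-- The isomorphism

module _ {A : Set} (_≼_ : A → A → Set) (≼-trans : ∀ {x y z} → x ≼ y → y ≼ z → x ≼ z) where

  maximum : ∀ (xs : List A) → xs ≢ [] → (∀ x y → x ∈ₗ xs → y ∈ₗ xs → x ≼ y ⊎ y ≼ x) →
            ∃ λ m → m ∈ₗ xs × (∀ x → x ∈ₗ xs → x ≼ m)
  maximum [] xs≢[] _ = ⊥-elim (xs≢[] refl)
  maximum (x ∷ []) _ total = x , here refl , λ { y (here refl) → reduce (total x x (here refl) (here refl)) }
  maximum (x ∷ xs@(_ ∷ _)) _ total with maximum xs (λ ()) (λ y z y∈ z∈ → total y z (there y∈) (there z∈))
  ... | m , m∈ , below-m with total x m (here refl) (there m∈)
  ...   | inj₁ x≼m = m , there m∈ , λ { y (here refl) → x≼m ; y (there y∈) → below-m y y∈ }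
  ...   | inj₂ m≼x = x , here refl , λ { y (here refl) → reduce (total x x (here refl) (here refl))
                                      ; y (there y∈) → ≼-trans (below-m y y∈) m≼x }

map≢[] : ∀ {A B : Set} {f : A → B} {xs} → xs ≢ [] → map f xs ≢ []
map≢[] {xs = []} xs≢[] = ⊥-elim (xs≢[] refl)
map≢[] {xs = _ ∷ _} _ ()

module _ (N : ℕ) .{{_ : NonZero N}} (d : ℕ) where

  private
    2N≡N+N : 2 * N ≡ N + N
    2N≡N+N = cong (N +_) (+-identityʳ N)

  vertex : Tuple (2 * N) d → Vec ℚ d
  vertex p = codeBarycenter (multiplicities p)

  multiplicities-isFaceCode : ∀ (p : Tuple (2 * N) d) → IsMultichain p → IsFaceCode N (multiplicities p)
  multiplicities-isFaceCode p mp = (λ i → subst (lookup (multiplicities p) i ≤_) 2N≡N+N (multiplicity-≤ p i))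
                                 , let j , aⱼ≡2N = multichain-full {p = p} mp 0<2N in j , trans aⱼ≡2N 2N≡N+N
    where
    0<2N : 0 < 2 * N
    0<2N = subst (0 <_) (sym 2N≡N+N) (<-≤-trans (>-nonZero⁻¹ N) (m≤m+n N N))

  vertex-isCMSVertex : ∀ (p : Tuple (2 * N) d) → IsMultichain p → IsCMSVertex N (vertex p)
  vertex-isCMSVertex p mp =
    let a≤2N , j , aⱼ≡2N = multiplicities-isFaceCode p mp
        k = chart N a a≤2N
    in j , k , faceOf N k a ,
       trans (barycenter≡codeBarycenter N j k (faceOf N k a))
             (cong codeBarycenter (faceCode-faceOf N {a} {a} a≤2N aⱼ≡2N (λ _ → ⊑-refl)))
    where
    a : Vec ℕ d
    a = multiplicities p

  isCMSVertex⇒vertex : ∀ v → IsCMSVertex N v → ∃ λ p → IsMultichain p × vertex p ≡ v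
  isCMSVertex⇒vertex v (j , k , φ , φ↦v) =
    multichainOf a , multichainOf-isMultichain a (j , trans (faceCode-top N j k φ) (sym 2N≡N+N)) ,
    trans (cong codeBarycenter (multiplicities-multichainOf a
                                  (λ i → subst (lookup a i ≤_) (sym 2N≡N+N) (proj₁ (faceCode-isFaceCode N j k φ) i))))
          (trans (sym (barycenter≡codeBarycenter N j k φ)) φ↦v)
    where
    a : Vec ℕ d
    a = faceCode N j k φ

  vertex-injective : ∀ (p q : Tuple (2 * N) d) → IsMultichain p → IsMultichain q → vertex p ≡ vertex q → p ≡ q
  vertex-injective p q mp mq p↦x = begin
    p                              ≡⟨ sym (multichainOf-multiplicities p mp) ⟩
    multichainOf (multiplicities p) ≡⟨ cong multichainOf (codeBarycenter-injective N {multiplicities p} {multiplicities q}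
                                         (multiplicities-isFaceCode p mp) (multiplicities-isFaceCode q mq) p↦x) ⟩
    multichainOf (multiplicities q) ≡⟨ multichainOf-multiplicities q mq ⟩
    q                              ∎
    where open ≡-Reasoning

  clique⇒comparable : ∀ (σ : List (Tuple (2 * N) d)) → All IsMultichain σ → (∀ p q → p ∈ₗ σ → q ∈ₗ σ → p ≢ q → AdjacentII p q) →
                      ∀ p q → p ∈ₗ σ → q ∈ₗ σ → multiplicities p ⊑ᵥ multiplicities q ⊎ multiplicities q ⊑ᵥ multiplicities p
  clique⇒comparable σ mσ adjacent p q p∈ q∈ with ≡-dec (≡-dec _≟ᵇ_) p q
  ... | yes refl = inj₁ (λ _ → ⊑-refl)
  ... | no p≢q with adjacent p q p∈ q∈ p≢q
  ...   | inj₁ p≼q = inj₂ (≼II⇒⊑ N {p = p} {q = q} (All.lookup mσ p∈) (All.lookup mσ q∈) p≼q)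
  ...   | inj₂ q≼p = inj₁ (≼II⇒⊑ N {p = q} {q = p} (All.lookup mσ q∈) (All.lookup mσ p∈) q≼p)

  clique⇒CMS : ∀ (σ : List (Tuple (2 * N) d)) → All IsMultichain σ → CliqueSimplexII σ → CMSSimplex N (map vertex σ)
  clique⇒CMS σ mσ (σ≢[] , _ , adjacent) = τ≢[] , j , k , map face σ , chain , members
    where
    comparable : ∀ p q → p ∈ₗ σ → q ∈ₗ σ → multiplicities p ⊑ᵥ multiplicities q ⊎ multiplicities q ⊑ᵥ multiplicities p
    comparable = clique⇒comparable σ mσ adjacent
    top : ∃ λ apex → apex ∈ₗ σ × (∀ q → q ∈ₗ σ → multiplicities q ⊑ᵥ multiplicities apex)
    top = maximum (λ p q → multiplicities p ⊑ᵥ multiplicities q) (λ {x} {y} {z} → ⊑ᵥ-trans {a = multiplicities z} {multiplicities y} {multiplicities x}) σ σ≢[] comparable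
    apex : Tuple (2 * N) d
    apex = proj₁ top
    apex-isFaceCode : IsFaceCode N (multiplicities apex)
    apex-isFaceCode = multiplicities-isFaceCode apex (All.lookup mσ (proj₁ (proj₂ top)))
    j : Fin d
    j = proj₁ (proj₂ apex-isFaceCode)
    k : Fin d → Fin N
    k = chart N (multiplicities apex) (proj₁ apex-isFaceCode)
    face : Tuple (2 * N) d → Face d
    face q = faceOf N k (multiplicities q)
    τ≢[] : map vertex σ ≢ []
    τ≢[] = map≢[] σ≢[]
    chain : ∀ φ ψ → φ ∈ₗ map face σ → ψ ∈ₗ map face σ → FaceLE j φ ψ ⊎ FaceLE j ψ φ
    chain φ ψ φ∈ ψ∈ with ∈-map⁻ face φ∈ | ∈-map⁻ face ψ∈
    ... | q , q∈ , refl | q′ , q′∈ , refl with comparable q q′ q∈ q′∈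
    ...   | inj₁ q⊑q′ = inj₁ (⊑⇒faceLE N j k {multiplicities q} {multiplicities q′} q⊑q′)
    ...   | inj₂ q′⊑q = inj₂ (⊑⇒faceLE N j k {multiplicities q′} {multiplicities q} q′⊑q)
    vertex∈ : ∀ q → q ∈ₗ σ → vertex q ∈ₗ map (barycenter N j k) (map face σ)
    vertex∈ q q∈ = subst (_∈ₗ map (barycenter N j k) (map face σ))
      (trans (barycenter≡codeBarycenter N j k (face q))
             (cong codeBarycenter (faceCode-faceOf N {multiplicities apex} {multiplicities q} (proj₁ apex-isFaceCode) (proj₂ (proj₂ apex-isFaceCode))
                                                   (proj₂ (proj₂ top) q q∈))))
      (∈-map⁺ (barycenter N j k) (∈-map⁺ face q∈))
    members : ∀ x → x ∈ₗ map vertex σ → x ∈ₗ map (barycenter N j k) (map face σ)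
    members x x∈ = let q , q∈ , x≡vq = ∈-map⁻ vertex x∈ in
      subst (_∈ₗ map (barycenter N j k) (map face σ)) (sym x≡vq) (vertex∈ q q∈)

  CMS⇒clique : ∀ (σ : List (Tuple (2 * N) d)) → All IsMultichain σ → CMSSimplex N (map vertex σ) → CliqueSimplexII σ
  CMS⇒clique σ mσ (τ≢[] , j , k , Fs , chain , members) = σ≢[] , mσ , adjacent
    where
    σ≢[] : σ ≢ []
    σ≢[] refl = τ≢[] refl
    face : ∀ p → p ∈ₗ σ → ∃ λ φ → φ ∈ₗ Fs × multiplicities p ≡ faceCode N j k φ
    face p p∈ = let φ , φ∈ , p↦φ = ∈-map⁻ (barycenter N j k) (members (vertex p) (∈-map⁺ vertex p∈)) in
      φ , φ∈ , codeBarycenter-injective N {multiplicities p} {faceCode N j k φ} (multiplicities-isFaceCode p (All.lookup mσ p∈))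
                 (faceCode-isFaceCode N j k φ) (trans p↦φ (barycenter≡codeBarycenter N j k φ))
    adjacent : ∀ p q → p ∈ₗ σ → q ∈ₗ σ → p ≢ q → AdjacentII p q
    adjacent p q p∈ q∈ _ =
      let φ , φ∈ , p≡φ = face p p∈
          ψ , ψ∈ , q≡ψ = face q q∈
          p⊑q : FaceLE j φ ψ → multiplicities p ⊑ᵥ multiplicities q
          p⊑q φ≤ψ = subst₂ _⊑ᵥ_ (sym p≡φ) (sym q≡ψ) (faceLE⇒⊑ N j k φ≤ψ)
          q⊑p : FaceLE j ψ φ → multiplicities q ⊑ᵥ multiplicities p
          q⊑p ψ≤φ = subst₂ _⊑ᵥ_ (sym q≡ψ) (sym p≡φ) (faceLE⇒⊑ N j k ψ≤φ)
      in [ (λ φ≤ψ → inj₂ (⊑⇒≼II N {p = q} {q = p} (All.lookup mσ q∈) (All.lookup mσ p∈) (p⊑q φ≤ψ)))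
         , (λ ψ≤φ → inj₁ (⊑⇒≼II N {p = p} {q = q} (All.lookup mσ p∈) (All.lookup mσ q∈) (q⊑p ψ≤φ))) ]′
         (chain φ ψ φ∈ ψ∈)

proposition5p2 : (N : ℕ) .{{_ : NonZero N}} → (d : ℕ) → 1 ≤ d →
    CliqueII≅CMS (2 * N) d N
proposition5p2 N d _ = vertex N d , vertex-isCMSVertex N d , isCMSVertex⇒vertex N d , vertex-injective N d ,
  λ σ mσ → mk⇔ (clique⇒CMS N d σ mσ) (CMS⇒clique N d σ mσ)
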